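{- For all nonnegative integers $k,n$, $d_{k,n}=a_{k,n}$.
   Context: For nonnegative integers $k,n$, let $a_{k,n}$ be the number of ways to partition a set consisting of $k$ marked points on a line and $n$ marked points on a parallel line into pairs, joining the two points of each pair by a straight segment, such that no two segments have a common point (in particular, no endpoint lies on another segment). We have $a_{0,0}=1$. $d_{k,n}$ is the number of pairs $(T_1,T_2)$, where $T_1$ is a domino tiling of a $2\times k$ rectangle and $T_2$ is a domino tiling of a $2\times n$ rectangle, such that $T_1$ and $T_2$ contain the same number of vertical dominoes. A $2\times 0$ rectangle has exactly one (empty) tiling. -}

module Defs where

open import Data.Bool.ListAction using (and)
open import Data.Bool using (Bool; true; false; _∧_; _∨_; not; if_then_else_)
open import Data.Nat using (ℕ; zero; suc; _+_; _≡ᵇ_; _≤ᵇ_; _⊔_; _⊓_)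
open import Data.Fin as Fin using (Fin; toℕ)
open import Data.Sum using (_⊎_; inj₁; inj₂)
open import Data.Product using (_×_; _,_; proj₁; proj₂)
open import Data.List using (List; []; _∷_; map; concatMap; filterᵇ; length; allFin; _++_; cartesianProduct)
open import Data.Vec using (Vec; []; _∷_; lookup)

vecsOver : {A : Set} → List A → (m : ℕ) → List (Vec A m)
vecsOver L zero    = [] ∷ []
vecsOver L (suc m) = concatMap (λ x → map (x ∷_) (vecsOver L m)) L

allᵇ : {A : Set} → (A → Bool) → List A → Bool
allᵇ p xs = and (map p xs)

count : {A : Set} → (A → Bool) → List A → ℕ
count p xs = length (filterᵇ p xs)

-- a_{k,n}: non-crossing matchings of k points on line 1 and n points on
-- a parallel line 2.  Point (inj₁ i) is the i-th point on line 1 (at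
-- coordinate i), point (inj₂ j) the j-th point on line 2.

Point : ℕ → ℕ → Set
Point k n = Fin k ⊎ Fin n

onLine2 : {k n : ℕ} → Point k n → Bool
onLine2 (inj₁ _) = false
onLine2 (inj₂ _) = true

pos : {k n : ℕ} → Point k n → ℕ
pos (inj₁ i) = toℕ i
pos (inj₂ j) = toℕ j

_≟ᵖ_ : {k n : ℕ} → Point k n → Point k n → Bool
inj₁ i ≟ᵖ inj₁ i' = toℕ i ≡ᵇ toℕ i'
inj₂ j ≟ᵖ inj₂ j' = toℕ j ≡ᵇ toℕ j'
_      ≟ᵖ _       = false

allPoints : (k n : ℕ) → List (Point k n)
allPoints k n = map inj₁ (allFin k) ++ map inj₂ (allFin n)

sameLine : {k n : ℕ} → Point k n → Point k n → Bool
sameLine x y = not (onLine2 x ∧ not (onLine2 y)) ∧ not (onLine2 y ∧ not (onLine2 x))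

pos2 : {k n : ℕ} → Point k n → Point k n → ℕ
pos2 u v = if onLine2 u then pos u else pos v

pos1 : {k n : ℕ} → Point k n → Point k n → ℕ
pos1 u v = if onLine2 u then pos v else pos u

-- endpoint position of segment uv on the line of w (only used when uv
-- joins the two lines)
posOn : {k n : ℕ} → Point k n → Point k n → Point k n → ℕ
posOn w u v = if onLine2 w then pos2 u v else pos1 u v

between : ℕ → ℕ → ℕ → Bool
between c a b = ((a ⊓ b) ≤ᵇ c) ∧ (c ≤ᵇ (a ⊔ b))

-- Do the straight segments [u,v] and [u',v'] have a common point?
-- (Exact description for points at integer coordinates on the lines
-- y = 0 (line 1) and y = 1 (line 2).)
meet : {k n : ℕ} → Point k n → Point k n → Point k n → Point k n → Bool
meet u v u' v' with sameLine u v | sameLine u' v'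
... | true  | true  = sameLine u u' ∧
                      ((pos u ⊓ pos v) ⊔ (pos u' ⊓ pos v') ≤ᵇ (pos u ⊔ pos v) ⊓ (pos u' ⊔ pos v'))
... | true  | false = between (posOn u u' v') (pos u) (pos v)
... | false | true  = between (posOn u' u v) (pos u') (pos v')
... | false | false = ((pos1 u v ≤ᵇ pos1 u' v') ∧ (pos2 u' v' ≤ᵇ pos2 u v))
                    ∨ ((pos1 u' v' ≤ᵇ pos1 u v) ∧ (pos2 u v ≤ᵇ pos2 u' v'))

-- A candidate pairing: the partner of each point, stored as a vector
-- for the points on line 1 and a vector for the points on line 2.
Pairing : ℕ → ℕ → Set
Pairing k n = Vec (Point k n) k × Vec (Point k n) n

partner : {k n : ℕ} → Pairing k n → Point k n → Point k n
partner (p₁ , p₂) (inj₁ i) = lookup p₁ i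
partner (p₁ , p₂) (inj₂ j) = lookup p₂ j

-- the pairing is a partition into pairs (fixed-point-free involution)
-- and no two distinct segments have a common point
validPairing : {k n : ℕ} → Pairing k n → Bool
validPairing {k} {n} p =
  allᵇ (λ x → (partner p (partner p x) ≟ᵖ x) ∧ not (partner p x ≟ᵖ x) ∧
             allᵇ (λ y → (y ≟ᵖ x) ∨ (y ≟ᵖ partner p x) ∨
                        not (meet x (partner p x) y (partner p y)))
                 (allPoints k n))
      (allPoints k n)

allPairings : (k n : ℕ) → List (Pairing k n)
allPairings k n = cartesianProduct (vecsOver (allPoints k n) k) (vecsOver (allPoints k n) n)

a : ℕ → ℕ → ℕ
a k n = count validPairing (allPairings k n)

-- d_{k,n}: domino tilings.

Cell : ℕ → Set
Cell m = Fin 2 × Fin m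

_≟ᶜ_ : {m : ℕ} → Cell m → Cell m → Bool
(r , c) ≟ᶜ (r' , c') = (toℕ r ≡ᵇ toℕ r') ∧ (toℕ c ≡ᵇ toℕ c')

adjacent : {m : ℕ} → Cell m → Cell m → Bool
adjacent (r , c) (r' , c') =
     ((toℕ r ≡ᵇ toℕ r') ∧ ((suc (toℕ c) ≡ᵇ toℕ c') ∨ (suc (toℕ c') ≡ᵇ toℕ c)))
  ∨ ((toℕ c ≡ᵇ toℕ c') ∧ not (toℕ r ≡ᵇ toℕ r'))

allCells : (m : ℕ) → List (Cell m)
allCells m = cartesianProduct (allFin 2) (allFin m)

-- candidate: the partner cell of each cell, row 0 and row 1
CellPairing : ℕ → Set
CellPairing m = Vec (Cell m) m × Vec (Cell m) m

mate : {m : ℕ} → CellPairing m → Cell m → Cell m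
mate (t , b) (Fin.zero , c)  = lookup t c
mate (t , b) (Fin.suc _ , c) = lookup b c

validTiling : {m : ℕ} → CellPairing m → Bool
validTiling {m} t =
  allᵇ (λ x → (mate t (mate t x) ≟ᶜ x) ∧ not (mate t x ≟ᶜ x) ∧ adjacent x (mate t x))
      (allCells m)

allCellPairings : (m : ℕ) → List (CellPairing m)
allCellPairings m = cartesianProduct (vecsOver (allCells m) m) (vecsOver (allCells m) m)

tilings : (m : ℕ) → List (CellPairing m)
tilings m = filterᵇ validTiling (allCellPairings m)

-- number of vertical dominoes: cells in row 0 whose mate is in the same
-- column (each vertical domino has exactly one cell in row 0)
verticals : {m : ℕ} → CellPairing m → ℕ
verticals {m} t =
  count (λ c → toℕ (proj₂ (mate t (Fin.zero , c))) ≡ᵇ toℕ c) (allFin m)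

d : ℕ → ℕ → ℕ
d k n = count (λ T → verticals (proj₁ T) ≡ᵇ verticals (proj₂ T))
              (cartesianProduct (tilings k) (tilings n))

module Submission where

open import Defs
open import Data.Nat using (ℕ)
open import Relation.Binary.PropositionalEquality using (_≡_)
open import Relation.Binary.PropositionalEquality using (_≢_; refl; sym; trans; cong; cong₂; subst; module ≡-Reasoning)
open import Data.Bool using (Bool; true; false; _∧_; _∨_; not)
open import Data.Bool.Properties using (T-≡)
open import Data.Nat using (zero; suc; _+_; _*_; _≡ᵇ_; _≤ᵇ_; _⊓_; _⊔_)
open import Data.Nat.Properties using (+-assoc; +-comm; *-distribˡ-+; *-zeroʳ; *-identityʳ; +-identityʳ; suc-injective; ≡ᵇ⇒≡; ≡⇒≡ᵇ)
open import Data.Fin as Fin using (Fin; toℕ)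
open import Data.Fin.Properties using (toℕ-injective)
open import Data.Sum using (_⊎_; inj₁; inj₂; map₂; swap)
open import Data.Product using (_×_; _,_; proj₁; proj₂; Σ)
open import Data.List using (List; []; _∷_; map; concatMap; filterᵇ; allFin; _++_; cartesianProduct; tabulate)
open import Data.List.Properties using (map-tabulate)
open import Data.Vec as V using (Vec; []; _∷_; lookup)
open import Data.Vec.Properties using (lookup-map; map-∘; map-cong; ∷-injective; tabulate∘lookup; tabulate-cong; lookup∘tabulate)
open import Data.Empty using (⊥; ⊥-elim)
open import Function using (_∘_; Equivalence)

-- Both numbers equal the number of pairs (c₁ , c₂) of compositions of k and
-- of n into parts 1 and 2 having equally many parts equal to 1.
--
-- A domino tiling of a 2 × m strip, read from the left, is a word in two
-- blocks: a vertical domino (width 1) and two stacked horizontal dominoes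
-- (width 2).  So tilings correspond to compositions of m into parts 1 and 2,
-- vertical dominoes to parts equal to 1.
--
-- A non-crossing matching of points on two parallel lines, read from the
-- left, is a word in three blocks: an arc joining the two leftmost points of
-- line 1, an arc joining those of line 2, or a rung joining the leftmost
-- points of the two lines (any other partner of a leftmost point forces two
-- segments to meet).  Arcs give parts 2 of c₁ resp. c₂, rungs a part 1 of
-- both; so matchings correspond to pairs with equally many ones.

-- Finite sums and counting

𝟙 : Bool → ℕ
𝟙 true  = 1
𝟙 false = 0

∑ : {A : Set} → List A → (A → ℕ) → ℕ
∑ []       f = 0
∑ (x ∷ xs) f = f x + ∑ xs f

∑-cong : {A : Set} (L : List A) {f g : A → ℕ} → (∀ x → f x ≡ g x) → ∑ L f ≡ ∑ L g
∑-cong []      h = refl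
∑-cong (x ∷ L) h = cong₂ _+_ (h x) (∑-cong L h)

∑-zero : {A : Set} (L : List A) (f : A → ℕ) → (∀ x → f x ≡ 0) → ∑ L f ≡ 0
∑-zero []      f h = refl
∑-zero (x ∷ L) f h rewrite h x = ∑-zero L f h

∑-++ : {A : Set} (L M : List A) (f : A → ℕ) → ∑ (L ++ M) f ≡ ∑ L f + ∑ M f
∑-++ []      M f = refl
∑-++ (x ∷ L) M f = trans (cong (f x +_) (∑-++ L M f)) (sym (+-assoc (f x) (∑ L f) (∑ M f)))

∑-map : {A B : Set} (g : A → B) (L : List A) (f : B → ℕ) → ∑ (map g L) f ≡ ∑ L (f ∘ g)
∑-map g []      f = refl
∑-map g (x ∷ L) f = cong (f (g x) +_) (∑-map g L f)

∑-concatMap : {A B : Set} (h : A → List B) (L : List A) (f : B → ℕ) →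
  ∑ (concatMap h L) f ≡ ∑ L (λ x → ∑ (h x) f)
∑-concatMap h []      f = refl
∑-concatMap h (x ∷ L) f =
  trans (∑-++ (h x) (concatMap h L) f) (cong (∑ (h x) f +_) (∑-concatMap h L f))

∑-cartesian : {A B : Set} (L : List A) (M : List B) (f : A × B → ℕ) →
  ∑ (cartesianProduct L M) f ≡ ∑ L (λ x → ∑ M (λ y → f (x , y)))
∑-cartesian []      M f = refl
∑-cartesian (x ∷ L) M f =
  trans (∑-++ (map (x ,_) M) _ f) (cong₂ _+_ (∑-map (x ,_) M f) (∑-cartesian L M f))

∑-+ : {A : Set} (L : List A) (f g : A → ℕ) → ∑ L (λ x → f x + g x) ≡ ∑ L f + ∑ L g
∑-+ []      f g = refl
∑-+ (x ∷ L) f g rewrite ∑-+ L f g = interchange (f x) (g x) (∑ L f) (∑ L g)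
  where
  interchange : ∀ p q r s → p + q + (r + s) ≡ p + r + (q + s)
  interchange p q r s rewrite +-assoc p q (r + s) | +-assoc p r (q + s)
    | sym (+-assoc q r s) | +-comm q r | +-assoc r q s = refl

∑-swap : {A B : Set} (L : List A) (M : List B) (f : A → B → ℕ) →
  ∑ L (λ x → ∑ M (f x)) ≡ ∑ M (λ y → ∑ L (λ x → f x y))
∑-swap []      M f = sym (∑-zero M _ (λ _ → refl))
∑-swap (x ∷ L) M f = trans (cong (∑ M (f x) +_) (∑-swap L M f)) (sym (∑-+ M (f x) _))

*-∑ : {A : Set} (c : ℕ) (L : List A) (f : A → ℕ) → c * ∑ L f ≡ ∑ L (λ x → c * f x)
*-∑ c []      f = *-zeroʳ c
*-∑ c (x ∷ L) f = trans (*-distribˡ-+ c (f x) (∑ L f)) (cong (c * f x +_) (*-∑ c L f))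

∑-filter : {A : Set} (p : A → Bool) (L : List A) (h : A → ℕ) →
  ∑ (filterᵇ p L) h ≡ ∑ L (λ x → 𝟙 (p x) * h x)
∑-filter p []      h = refl
∑-filter p (x ∷ L) h with p x
... | true  = cong₂ _+_ (sym (+-identityʳ (h x))) (∑-filter p L h)
... | false = ∑-filter p L h

count≡∑ : {A : Set} (p : A → Bool) (L : List A) → count p L ≡ ∑ L (𝟙 ∘ p)
count≡∑ p []      = refl
count≡∑ p (x ∷ L) with p x
... | true  = cong suc (count≡∑ p L)
... | false = count≡∑ p L

𝟙-∧ : ∀ b c → 𝟙 (b ∧ c) ≡ 𝟙 b * 𝟙 c
𝟙-∧ true  c = sym (+-identityʳ (𝟙 c))
𝟙-∧ false c = refl

count-cartesian-filter : {A B : Set} (f : A → Bool) (g : B → Bool) (r : A × B → Bool)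
  (L : List A) (M : List B) →
  ∑ (cartesianProduct (filterᵇ f L) (filterᵇ g M)) (𝟙 ∘ r) ≡
  ∑ (cartesianProduct L M) (λ z → 𝟙 (f (proj₁ z) ∧ g (proj₂ z) ∧ r z))
count-cartesian-filter f g r L M = begin
  ∑ (cartesianProduct (filterᵇ f L) (filterᵇ g M)) (𝟙 ∘ r)
    ≡⟨ ∑-cartesian (filterᵇ f L) (filterᵇ g M) _ ⟩
  ∑ (filterᵇ f L) (λ x → ∑ (filterᵇ g M) (λ y → 𝟙 (r (x , y))))
    ≡⟨ ∑-filter f L _ ⟩
  ∑ L (λ x → 𝟙 (f x) * ∑ (filterᵇ g M) (λ y → 𝟙 (r (x , y))))
    ≡⟨ ∑-cong L (λ x → cong (𝟙 (f x) *_) (∑-filter g M _)) ⟩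
  ∑ L (λ x → 𝟙 (f x) * ∑ M (λ y → 𝟙 (g y) * 𝟙 (r (x , y))))
    ≡⟨ ∑-cong L (λ x → trans (*-∑ (𝟙 (f x)) M _) (∑-cong M (λ y →
         sym (trans (𝟙-∧ (f x) _) (cong (𝟙 (f x) *_) (𝟙-∧ (g y) (r (x , y)))))))) ⟩
  ∑ L (λ x → ∑ M (λ y → 𝟙 (f x ∧ g y ∧ r (x , y))))
    ≡⟨ sym (∑-cartesian L M _) ⟩
  ∑ (cartesianProduct L M) (λ z → 𝟙 (f (proj₁ z) ∧ g (proj₂ z) ∧ r z)) ∎
  where open ≡-Reasoning

record BoolEq (A : Set) : Set where
  field
    eq        : A → A → Bool
    sound     : ∀ x y → eq x y ≡ true → x ≡ y
    reflexive : ∀ x → eq x x ≡ true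
open BoolEq

true≢false : true ≢ false
true≢false ()

eq-false⇒≢ : {A : Set} (E : BoolEq A) {x y : A} → eq E x y ≡ false → x ≢ y
eq-false⇒≢ E {x} e refl = true≢false (trans (sym (reflexive E x)) e)

Listing : {A : Set} → BoolEq A → List A → Set
Listing E L = ∀ z → ∑ L (λ x → 𝟙 (eq E x z)) ≡ 1

count-by-bijection : {X Y : Set} (EX : BoolEq X) (EY : BoolEq Y) (L : List X) (M : List Y) →
  Listing EX L → Listing EY M → (p : X → Bool) (q : Y → Bool) (enc : Y → X) →
  (into : ∀ y → q y ≡ true → p (enc y) ≡ true) →
  (onto : ∀ x → p x ≡ true → Σ Y λ y → q y ≡ true × enc y ≡ x) →
  (inj : ∀ y y' → q y ≡ true → q y' ≡ true → enc y ≡ enc y' → y ≡ y') →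
  ∑ L (𝟙 ∘ p) ≡ ∑ M (𝟙 ∘ q)
count-by-bijection {X} {Y} EX EY L M EL EM p q enc into onto inj = sym (begin
  ∑ M (𝟙 ∘ q)
    ≡⟨ ∑-cong M (λ y → sym (trans (cong (𝟙 (q y) *_) (EL (enc y))) (*-identityʳ _))) ⟩
  ∑ M (λ y → 𝟙 (q y) * ∑ L (λ x → 𝟙 (eq EX x (enc y))))
    ≡⟨ ∑-cong M (λ y → *-∑ (𝟙 (q y)) L _) ⟩
  ∑ M (λ y → ∑ L (λ x → fibre x y))
    ≡⟨ sym (∑-swap L M fibre) ⟩
  ∑ L (λ x → ∑ M (fibre x))
    ≡⟨ ∑-cong L fibre-size ⟩
  ∑ L (𝟙 ∘ p) ∎)
  where
  open ≡-Reasoning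
  fibre : X → Y → ℕ
  fibre x y = 𝟙 (q y) * 𝟙 (eq EX x (enc y))

  fibre-size : ∀ x → ∑ M (fibre x) ≡ 𝟙 (p x)
  fibre-size x with p x in px
  ... | false = ∑-zero M (fibre x) empty
    where
    empty : ∀ y → fibre x y ≡ 0
    empty y with q y in qy | eq EX x (enc y) in ex
    ... | false | _     = refl
    ... | true  | false = refl
    ... | true  | true  =
      ⊥-elim (true≢false (trans (sym (into y qy)) (trans (cong p (sym (sound EX _ _ ex))) px)))
  ... | true with onto x px
  ... | y₀ , qy₀ , ey₀ = trans (∑-cong M single) (EM y₀)
    where
    single : ∀ y → fibre x y ≡ 𝟙 (eq EY y y₀)
    single y with eq EY y y₀ in e
    ... | true rewrite sound EY _ _ e | qy₀ | ey₀ | reflexive EX x = refl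
    ... | false with q y in qy | eq EX x (enc y) in ex
    ... | false | _     = refl
    ... | true  | false = refl
    ... | true  | true  = ⊥-elim (eq-false⇒≢ EY e
          (inj y y₀ qy qy₀ (trans (sym (sound EX _ _ ex)) (sym ey₀))))

∑-pair-once : {A B C : Set} (EA : BoolEq A) (EB : BoolEq B) (g : A → B → C) (eqC : C → C → Bool)
  (g-eq : ∀ x y z w → eqC (g x y) (g z w) ≡ (eq EA x z ∧ eq EB y w))
  (L : List A) (M : List B) → Listing EA L → Listing EB M → ∀ z w →
  ∑ L (λ x → ∑ M (λ y → 𝟙 (eqC (g x y) (g z w)))) ≡ 1
∑-pair-once EA EB g eqC g-eq L M EL EM z w = trans (∑-cong L inner) (EL z)
  where
  inner : ∀ x → ∑ M (λ y → 𝟙 (eqC (g x y) (g z w))) ≡ 𝟙 (eq EA x z)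
  inner x = begin
    ∑ M (λ y → 𝟙 (eqC (g x y) (g z w)))
      ≡⟨ ∑-cong M (λ y → trans (cong 𝟙 (g-eq x y z w)) (𝟙-∧ (eq EA x z) (eq EB y w))) ⟩
    ∑ M (λ y → 𝟙 (eq EA x z) * 𝟙 (eq EB y w))
      ≡⟨ sym (*-∑ (𝟙 (eq EA x z)) M _) ⟩
    𝟙 (eq EA x z) * ∑ M (λ y → 𝟙 (eq EB y w))
      ≡⟨ cong (𝟙 (eq EA x z) *_) (EM w) ⟩
    𝟙 (eq EA x z) * 1
      ≡⟨ *-identityʳ _ ⟩
    𝟙 (eq EA x z) ∎
    where open ≡-Reasoning

∧-true : ∀ {b c} → (b ∧ c) ≡ true → b ≡ true × c ≡ true
∧-true {true} {true} e = refl , refl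

≡ᵇ-sound : ∀ m n → (m ≡ᵇ n) ≡ true → m ≡ n
≡ᵇ-sound m n e = ≡ᵇ⇒≡ m n (Equivalence.from T-≡ e)

≡ᵇ-refl : ∀ m → (m ≡ᵇ m) ≡ true
≡ᵇ-refl m = Equivalence.to T-≡ (≡⇒≡ᵇ m m refl)

EqFin : ∀ m → BoolEq (Fin m)
EqFin m = record
  { eq        = λ i j → toℕ i ≡ᵇ toℕ j
  ; sound     = λ i j e → toℕ-injective (≡ᵇ-sound _ _ e)
  ; reflexive = λ i → ≡ᵇ-refl (toℕ i) }

EqPoint : ∀ k n → BoolEq (Point k n)
EqPoint k n = record { eq = _≟ᵖ_ ; sound = sound-≟ᵖ ; reflexive = reflexive-≟ᵖ }
  where
  sound-≟ᵖ : ∀ x y → (x ≟ᵖ y) ≡ true → x ≡ y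
  sound-≟ᵖ (inj₁ i) (inj₁ j) e = cong inj₁ (sound (EqFin k) i j e)
  sound-≟ᵖ (inj₂ i) (inj₂ j) e = cong inj₂ (sound (EqFin n) i j e)
  reflexive-≟ᵖ : ∀ x → (x ≟ᵖ x) ≡ true
  reflexive-≟ᵖ (inj₁ i) = ≡ᵇ-refl (toℕ i)
  reflexive-≟ᵖ (inj₂ i) = ≡ᵇ-refl (toℕ i)

Eq× : {A B : Set} → BoolEq A → BoolEq B → BoolEq (A × B)
Eq× EA EB = record
  { eq        = λ x y → eq EA (proj₁ x) (proj₁ y) ∧ eq EB (proj₂ x) (proj₂ y)
  ; sound     = λ { (x , y) (x' , y') e →
                    cong₂ _,_ (sound EA x x' (proj₁ (∧-true e))) (sound EB y y' (proj₂ (∧-true e))) }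
  ; reflexive = λ { (x , y) → cong₂ _∧_ (reflexive EA x) (reflexive EB y) } }

eqVec : {A : Set} → BoolEq A → ∀ {m} → Vec A m → Vec A m → Bool
eqVec E []       []       = true
eqVec E (x ∷ xs) (y ∷ ys) = eq E x y ∧ eqVec E xs ys

EqVec : {A : Set} → BoolEq A → ∀ m → BoolEq (Vec A m)
EqVec {A} E m = record { eq = eqVec E ; sound = sound-vec ; reflexive = reflexive-vec }
  where
  sound-vec : ∀ {m} (xs ys : Vec A m) → eqVec E xs ys ≡ true → xs ≡ ys
  sound-vec []       []       e = refl
  sound-vec (x ∷ xs) (y ∷ ys) e =
    cong₂ _∷_ (sound E x y (proj₁ (∧-true e))) (sound-vec xs ys (proj₂ (∧-true e)))
  reflexive-vec : ∀ {m} (xs : Vec A m) → eqVec E xs xs ≡ true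
  reflexive-vec []       = refl
  reflexive-vec (x ∷ xs) = cong₂ _∧_ (reflexive E x) (reflexive-vec xs)

∑-allFin-suc : ∀ m (f : Fin (suc m) → ℕ) → ∑ (tabulate Fin.suc) f ≡ ∑ (allFin m) (f ∘ Fin.suc)
∑-allFin-suc m f = trans (cong (λ L → ∑ L f) (sym (map-tabulate (λ i → i) Fin.suc))) (∑-map Fin.suc (allFin m) f)

allFin-listing : ∀ m → Listing (EqFin m) (allFin m)
allFin-listing (suc m) Fin.zero    = cong suc (trans (∑-allFin-suc m _) (∑-zero (allFin m) _ (λ _ → refl)))
allFin-listing (suc m) (Fin.suc z) = trans (∑-allFin-suc m _) (allFin-listing m z)

allPoints-listing : ∀ k n → Listing (EqPoint k n) (allPoints k n)
allPoints-listing k n z = begin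
  ∑ (map inj₁ (allFin k) ++ map inj₂ (allFin n)) (λ x → 𝟙 (x ≟ᵖ z))
    ≡⟨ ∑-++ (map inj₁ (allFin k)) _ _ ⟩
  ∑ (map inj₁ (allFin k)) (λ x → 𝟙 (x ≟ᵖ z)) + ∑ (map inj₂ (allFin n)) (λ x → 𝟙 (x ≟ᵖ z))
    ≡⟨ cong₂ _+_ (∑-map inj₁ (allFin k) _) (∑-map inj₂ (allFin n) _) ⟩
  ∑ (allFin k) (λ i → 𝟙 (inj₁ i ≟ᵖ z)) + ∑ (allFin n) (λ j → 𝟙 (inj₂ j ≟ᵖ z))
    ≡⟨ on-lines z ⟩
  1 ∎
  where
  open ≡-Reasoning
  on-lines : ∀ z → ∑ (allFin k) (λ i → 𝟙 (inj₁ i ≟ᵖ z)) + ∑ (allFin n) (λ j → 𝟙 (inj₂ j ≟ᵖ z)) ≡ 1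
  on-lines (inj₁ i) = trans (cong₂ _+_ (allFin-listing k i) (∑-zero (allFin n) _ (λ _ → refl))) refl
  on-lines (inj₂ j) = cong₂ _+_ (∑-zero (allFin k) _ (λ _ → refl)) (allFin-listing n j)

cartesian-listing : {A B : Set} (EA : BoolEq A) (EB : BoolEq B) (L : List A) (M : List B) →
  Listing EA L → Listing EB M → Listing (Eq× EA EB) (cartesianProduct L M)
cartesian-listing EA EB L M EL EM (z , w) =
  trans (∑-cartesian L M _) (∑-pair-once EA EB _,_ _ (λ _ _ _ _ → refl) L M EL EM z w)

vecsOver-listing : {A : Set} (E : BoolEq A) (L : List A) → Listing E L →
  ∀ m → Listing (EqVec E m) (vecsOver L m)
vecsOver-listing E L EL zero    [] = refl
vecsOver-listing E L EL (suc m) (z ∷ zs) = begin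
  ∑ (concatMap (λ x → map (x ∷_) (vecsOver L m)) L) (λ v → 𝟙 (eqVec E v (z ∷ zs)))
    ≡⟨ ∑-concatMap _ L _ ⟩
  ∑ L (λ x → ∑ (map (x ∷_) (vecsOver L m)) (λ v → 𝟙 (eqVec E v (z ∷ zs))))
    ≡⟨ ∑-cong L (λ x → ∑-map (x ∷_) (vecsOver L m) _) ⟩
  ∑ L (λ x → ∑ (vecsOver L m) (λ v → 𝟙 (eqVec E (x ∷ v) (z ∷ zs))))
    ≡⟨ ∑-pair-once E (EqVec E m) _∷_ (eqVec E) (λ _ _ _ _ → refl) L (vecsOver L m)
         EL (vecsOver-listing E L EL m) z zs ⟩
  1 ∎
  where open ≡-Reasoning

allᵇ-elim : {A : Set} (E : BoolEq A) (f : A → Bool) (L : List A) → allᵇ f L ≡ true →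
  ∀ z → ∑ L (λ x → 𝟙 (eq E x z)) ≡ 1 → f z ≡ true
allᵇ-elim E f (x ∷ L) h z once with eq E x z in e
... | true rewrite sound E x z e = proj₁ (∧-true h)
... | false = allᵇ-elim E f L (proj₂ (∧-true h)) z once

allᵇ-intro : {A : Set} (f : A → Bool) (L : List A) → (∀ x → f x ≡ true) → allᵇ f L ≡ true
allᵇ-intro f []      h = refl
allᵇ-intro f (x ∷ L) h rewrite h x = allᵇ-intro f L h

-- Compositions into parts 1 and 2

data Comp : ℕ → Set where
  done : Comp zero
  one  : ∀ {m} → Comp m → Comp (suc m)
  two  : ∀ {m} → Comp m → Comp (suc (suc m))

ones : ∀ {m} → Comp m → ℕ
ones done    = 0
ones (one c) = suc (ones c)
ones (two c) = ones c

EqComp : ∀ m → BoolEq (Comp m)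
EqComp m = record { eq = eqComp ; sound = sound-comp ; reflexive = reflexive-comp }
  where
  eqComp : ∀ {m} → Comp m → Comp m → Bool
  eqComp done    done     = true
  eqComp (one c) (one c') = eqComp c c'
  eqComp (one c) (two c') = false
  eqComp (two c) (one c') = false
  eqComp (two c) (two c') = eqComp c c'
  sound-comp : ∀ {m} (c c' : Comp m) → eqComp c c' ≡ true → c ≡ c'
  sound-comp done    done     e = refl
  sound-comp (one c) (one c') e = cong one (sound-comp c c' e)
  sound-comp (two c) (two c') e = cong two (sound-comp c c' e)
  reflexive-comp : ∀ {m} (c : Comp m) → eqComp c c ≡ true
  reflexive-comp done    = refl
  reflexive-comp (one c) = reflexive-comp c
  reflexive-comp (two c) = reflexive-comp c

comps : ∀ m → List (Comp m)
comps zero          = done ∷ []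
comps (suc zero)    = map one (comps zero)
comps (suc (suc m)) = map one (comps (suc m)) ++ map two (comps m)

comps-listing : ∀ m → Listing (EqComp m) (comps m)
comps-listing zero          done    = refl
comps-listing (suc zero)    (one c) =
  trans (∑-map one (comps zero) (λ x → 𝟙 (eq (EqComp 1) x (one c)))) (comps-listing zero c)
comps-listing (suc (suc m)) c = trans (∑-++ (map one (comps (suc m))) _ _)
  (trans (cong₂ _+_ (∑-map one (comps (suc m)) _) (∑-map two (comps m) _)) (by-first-part c))
  where
  by-first-part : ∀ c → ∑ (comps (suc m)) (λ x → 𝟙 (eq (EqComp _) (one x) c))
                      + ∑ (comps m) (λ x → 𝟙 (eq (EqComp _) (two x) c)) ≡ 1
  by-first-part (one c) = trans (cong₂ _+_ (comps-listing (suc m) c) (∑-zero (comps m) _ (λ _ → refl))) refl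
  by-first-part (two c) = cong₂ _+_ (∑-zero (comps (suc m)) _ (λ _ → refl)) (comps-listing m c)

balanced : ∀ {k n} → Comp k × Comp n → Bool
balanced (c₁ , c₂) = ones c₁ ≡ᵇ ones c₂

balancedPairs : ℕ → ℕ → ℕ
balancedPairs k n = ∑ (cartesianProduct (comps k) (comps n)) (𝟙 ∘ balanced)

comp-pairs-listing : ∀ k n → Listing (Eq× (EqComp k) (EqComp n)) (cartesianProduct (comps k) (comps n))
comp-pairs-listing k n = cartesian-listing (EqComp k) (EqComp n) (comps k) (comps n) (comps-listing k) (comps-listing n)

map-injective : {A B : Set} {m : ℕ} (f : A → B) → (∀ {x y} → f x ≡ f y → x ≡ y) →
  (u v : Vec A m) → V.map f u ≡ V.map f v → u ≡ v
map-injective f f-inj []      []      e = refl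
map-injective f f-inj (x ∷ u) (y ∷ v) e =
  cong₂ _∷_ (f-inj (proj₁ (∷-injective e))) (map-injective f f-inj u v (proj₂ (∷-injective e)))

vec-ext : {A : Set} {m : ℕ} (v w : Vec A m) → (∀ i → lookup v i ≡ lookup w i) → v ≡ w
vec-ext v w h = trans (sym (tabulate∘lookup v)) (trans (tabulate-cong h) (tabulate∘lookup w))

Image : {A B : Set} → (A → B) → B → Set
Image {A} s z = Σ A λ x → s x ≡ z

preimage : {A B : Set} {m : ℕ} (s : A → B) (v : Vec B m) →
  (∀ i → Image s (lookup v i)) → Σ (Vec A m) λ u → V.map s u ≡ v
preimage s []      h = [] , refl
preimage s (y ∷ v) h with h Fin.zero | preimage s v (h ∘ Fin.suc)
... | x , sx≡y | u , su≡v = x ∷ u , cong₂ _∷_ sx≡y su≡v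

-- This is how a tiling or matching that is already known on
-- the leftmost block is restricted to the rest.
image-closed : {X X' : Set} (s : X → X') (New : X' → Set) (f : X' → X') →
  (∀ z → Image s z ⊎ New z) → (∀ x → New (s x) → ⊥) →
  (∀ z → New z → New (f z)) → (∀ z → f (f z) ≡ z) →
  ∀ x → Image s (f (s x))
image-closed s New f classify old-not-new f-new f-inv x with classify (f (s x))
... | inj₁ old = old
... | inj₂ new = ⊥-elim (old-not-new x (subst New (f-inv (s x)) (f-new _ new)))

-- Domino tilings of a 2 × m strip

false≢true : false ≢ true
false≢true ()

not-true : ∀ {b} → not b ≡ true → b ≡ false
not-true {false} e = refl

EqCell : ∀ m → BoolEq (Cell m)
EqCell m = Eq× (EqFin 2) (EqFin m)

allCells-listing : ∀ m → Listing (EqCell m) (allCells m)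
allCells-listing m =
  cartesian-listing (EqFin 2) (EqFin m) (allFin 2) (allFin m) (allFin-listing 2) (allFin-listing m)

record TiledAt {m : ℕ} (T : CellPairing m) (x : Cell m) : Set where
  field
    involutive : mate T (mate T x) ≡ x
    moved      : mate T x ≢ x
    neighbour  : adjacent x (mate T x) ≡ true
open TiledAt

IsTiling : ∀ {m} → CellPairing m → Set
IsTiling T = ∀ x → TiledAt T x

validTiling⇒IsTiling : ∀ {m} (T : CellPairing m) → validTiling T ≡ true → IsTiling T
validTiling⇒IsTiling {m} T valid x = record
  { involutive = sound (EqCell m) _ _ (proj₁ at-x)
  ; moved      = eq-false⇒≢ (EqCell m) (not-true (proj₁ (∧-true (proj₂ at-x))))
  ; neighbour  = proj₂ (∧-true (proj₂ at-x)) }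
  where
  at-x : (mate T (mate T x) ≟ᶜ x) ≡ true × (not (mate T x ≟ᶜ x) ∧ adjacent x (mate T x)) ≡ true
  at-x = ∧-true (allᵇ-elim (EqCell m) _ (allCells m) valid x (allCells-listing m x))

IsTiling⇒validTiling : ∀ {m} (T : CellPairing m) → IsTiling T → validTiling T ≡ true
IsTiling⇒validTiling {m} T tiling = allᵇ-intro _ (allCells m) at
  where
  at : ∀ x → ((mate T (mate T x) ≟ᶜ x) ∧ not (mate T x ≟ᶜ x) ∧ adjacent x (mate T x)) ≡ true
  at x rewrite involutive (tiling x) | reflexive (EqCell m) x | neighbour (tiling x)
    with mate T x ≟ᶜ x in e
  ... | true  = ⊥-elim (moved (tiling x) (sound (EqCell m) _ _ e))
  ... | false = refl

top bottom : Fin 2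
top    = Fin.zero
bottom = Fin.suc Fin.zero

shift : ∀ {m} → Cell m → Cell (suc m)
shift (r , c) = r , Fin.suc c

shift-injective : ∀ {m} {x y : Cell m} → shift x ≡ shift y → x ≡ y
shift-injective {x = _ , _} {_ , _} refl = refl

shift-adjacent : ∀ {m} (x y : Cell m) → adjacent (shift x) (shift y) ≡ adjacent x y
shift-adjacent (_ , _) (_ , _) = refl

module ShiftedTiling {m m' : ℕ} (s : Cell m → Cell m') (s-inj : ∀ {x y} → s x ≡ s y → x ≡ y)
  (s-adj : ∀ x y → adjacent (s x) (s y) ≡ adjacent x y)
  (T : CellPairing m) (T' : CellPairing m') (commute : ∀ x → mate T' (s x) ≡ s (mate T x)) where

  forward : ∀ x → TiledAt T x → TiledAt T' (s x)
  forward x at = record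
    { involutive = trans (cong (mate T') (commute x)) (trans (commute _) (cong s (involutive at)))
    ; moved      = λ e → moved at (s-inj (trans (sym (commute x)) e))
    ; neighbour  = trans (cong (adjacent (s x)) (commute x)) (trans (s-adj x _) (neighbour at)) }

  backward : ∀ x → TiledAt T' (s x) → TiledAt T x
  backward x at = record
    { involutive = s-inj (trans (sym (commute _)) (trans (cong (mate T') (sym (commute x))) (involutive at)))
    ; moved      = λ e → moved at (trans (commute x) (cong s e))
    ; neighbour  = trans (sym (s-adj x _)) (trans (cong (adjacent (s x)) (sym (commute x))) (neighbour at)) }

addVertical : ∀ {m} → CellPairing m → CellPairing (suc m)
addVertical (t , b) = ((bottom , Fin.zero) ∷ V.map shift t) , ((top , Fin.zero) ∷ V.map shift b)

addHorizontals : ∀ {m} → CellPairing m → CellPairing (suc (suc m))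
addHorizontals (t , b) =
  ((top    , Fin.suc Fin.zero) ∷ (top    , Fin.zero) ∷ V.map (shift ∘ shift) t) ,
  ((bottom , Fin.suc Fin.zero) ∷ (bottom , Fin.zero) ∷ V.map (shift ∘ shift) b)

mate-addVertical : ∀ {m} (T : CellPairing m) x → mate (addVertical T) (shift x) ≡ shift (mate T x)
mate-addVertical (t , b) (Fin.zero  , c) = lookup-map c shift t
mate-addVertical (t , b) (Fin.suc _ , c) = lookup-map c shift b

mate-addHorizontals : ∀ {m} (T : CellPairing m) x →
  mate (addHorizontals T) (shift (shift x)) ≡ shift (shift (mate T x))
mate-addHorizontals (t , b) (Fin.zero  , c) = lookup-map c (shift ∘ shift) t
mate-addHorizontals (t , b) (Fin.suc _ , c) = lookup-map c (shift ∘ shift) b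

module VerticalShift {m : ℕ} (T : CellPairing m) =
  ShiftedTiling shift shift-injective shift-adjacent T (addVertical T) (mate-addVertical T)

module HorizontalShift {m : ℕ} (T : CellPairing m) =
  ShiftedTiling (shift ∘ shift) (shift-injective ∘ shift-injective)
    (λ x y → trans (shift-adjacent (shift x) (shift y)) (shift-adjacent x y)) T (addHorizontals T) (mate-addHorizontals T)

addVertical-tiling : ∀ {m} (T : CellPairing m) → IsTiling T → IsTiling (addVertical T)
addVertical-tiling T tiling (Fin.zero          , Fin.zero)  = record { involutive = refl ; moved = λ () ; neighbour = refl }
addVertical-tiling T tiling (Fin.suc Fin.zero  , Fin.zero)  = record { involutive = refl ; moved = λ () ; neighbour = refl }
addVertical-tiling T tiling (r , Fin.suc c) = VerticalShift.forward T (r , c) (tiling (r , c))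

addHorizontals-tiling : ∀ {m} (T : CellPairing m) → IsTiling T → IsTiling (addHorizontals T)
addHorizontals-tiling T tiling (Fin.zero         , Fin.zero)          = record { involutive = refl ; moved = λ () ; neighbour = refl }
addHorizontals-tiling T tiling (Fin.suc Fin.zero , Fin.zero)          = record { involutive = refl ; moved = λ () ; neighbour = refl }
addHorizontals-tiling T tiling (Fin.zero         , Fin.suc Fin.zero)  = record { involutive = refl ; moved = λ () ; neighbour = refl }
addHorizontals-tiling T tiling (Fin.suc Fin.zero , Fin.suc Fin.zero)  = record { involutive = refl ; moved = λ () ; neighbour = refl }
addHorizontals-tiling T tiling (r , Fin.suc (Fin.suc c)) = HorizontalShift.forward T (r , c) (tiling (r , c))

tilingOf : ∀ {m} → Comp m → CellPairing m
tilingOf done    = [] , []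
tilingOf (one c) = addVertical (tilingOf c)
tilingOf (two c) = addHorizontals (tilingOf c)

tilingOf-tiling : ∀ {m} (c : Comp m) → IsTiling (tilingOf c)
tilingOf-tiling done    (_ , ())
tilingOf-tiling (one c) = addVertical-tiling (tilingOf c) (tilingOf-tiling c)
tilingOf-tiling (two c) = addHorizontals-tiling (tilingOf c) (tilingOf-tiling c)

-- The first block is visible in the top-left cell.
tilingOf-injective : ∀ {m} (c c' : Comp m) → tilingOf c ≡ tilingOf c' → c ≡ c'
tilingOf-injective done    done     e = refl
tilingOf-injective (one c) (one c') e = cong one (tilingOf-injective c c' (cong₂ _,_
  (map-injective shift shift-injective _ _ (cong (V.tail ∘ proj₁) e))
  (map-injective shift shift-injective _ _ (cong (V.tail ∘ proj₂) e))))
tilingOf-injective (two c) (two c') e = cong two (tilingOf-injective c c' (cong₂ _,_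
  (map-injective (shift ∘ shift) (shift-injective ∘ shift-injective) _ _ (cong (V.tail ∘ V.tail ∘ proj₁) e))
  (map-injective (shift ∘ shift) (shift-injective ∘ shift-injective) _ _ (cong (V.tail ∘ V.tail ∘ proj₂) e))))
tilingOf-injective (one c) (two c') e with cong (V.head ∘ proj₁) e
... | ()
tilingOf-injective (two c) (one c') e with cong (V.head ∘ proj₁) e
... | ()

peel-vertical : ∀ {m} (t b : Vec (Cell (suc m)) m) (b₀ : Cell (suc m)) →
  IsTiling (((bottom , Fin.zero) ∷ t) , (b₀ ∷ b)) →
  Σ (CellPairing m) λ T' → IsTiling T' × addVertical T' ≡ (((bottom , Fin.zero) ∷ t) , (b₀ ∷ b))
peel-vertical {m} t b b₀ tiling = T' , (λ x → VerticalShift.backward T' x (tiling' (shift x))) , T'-extends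
  where
  T : CellPairing (suc m)
  T = ((bottom , Fin.zero) ∷ t) , (b₀ ∷ b)
  b₀≡ : b₀ ≡ (top , Fin.zero)
  b₀≡ = involutive (tiling (top , Fin.zero))
  FirstColumn : Cell (suc m) → Set
  FirstColumn z = proj₂ z ≡ Fin.zero
  classify : ∀ z → Image shift z ⊎ FirstColumn z
  classify (r , Fin.zero)  = inj₂ refl
  classify (r , Fin.suc c) = inj₁ ((r , c) , refl)
  first-column-closed : ∀ z → FirstColumn z → FirstColumn (mate T z)
  first-column-closed (Fin.zero          , Fin.zero) refl = refl
  first-column-closed (Fin.suc Fin.zero  , Fin.zero) refl = cong proj₂ b₀≡
  mates-shifted : ∀ x → Image shift (mate T (shift x))
  mates-shifted = image-closed shift FirstColumn (mate T) classify (λ _ ())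
                    first-column-closed (λ z → involutive (tiling z))
  top-row : Σ (Vec (Cell m) m) λ u → V.map shift u ≡ t
  top-row = preimage shift t (λ i → mates-shifted (top , i))
  bottom-row : Σ (Vec (Cell m) m) λ u → V.map shift u ≡ b
  bottom-row = preimage shift b (λ i → mates-shifted (bottom , i))
  T' : CellPairing m
  T' = proj₁ top-row , proj₁ bottom-row
  T'-extends : addVertical T' ≡ T
  T'-extends = cong₂ _,_ (cong (_ ∷_) (proj₂ top-row)) (cong₂ _∷_ (sym b₀≡) (proj₂ bottom-row))
  tiling' : IsTiling (addVertical T')
  tiling' = subst IsTiling (sym T'-extends) tiling

peel-horizontals : ∀ {m} (t b : Vec (Cell (suc (suc m))) m) (t₁ b₁ : Cell (suc (suc m))) →
  IsTiling (((top , Fin.suc Fin.zero) ∷ t₁ ∷ t) , ((bottom , Fin.suc Fin.zero) ∷ b₁ ∷ b)) →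
  Σ (CellPairing m) λ T' → IsTiling T' ×
    addHorizontals T' ≡ (((top , Fin.suc Fin.zero) ∷ t₁ ∷ t) , ((bottom , Fin.suc Fin.zero) ∷ b₁ ∷ b))
peel-horizontals {m} t b t₁ b₁ tiling =
  T' , (λ x → HorizontalShift.backward T' x (tiling' (shift (shift x)))) , T'-extends
  where
  T : CellPairing (suc (suc m))
  T = ((top , Fin.suc Fin.zero) ∷ t₁ ∷ t) , ((bottom , Fin.suc Fin.zero) ∷ b₁ ∷ b)
  t₁≡ : t₁ ≡ (top , Fin.zero)
  t₁≡ = involutive (tiling (top , Fin.zero))
  b₁≡ : b₁ ≡ (bottom , Fin.zero)
  b₁≡ = involutive (tiling (bottom , Fin.zero))
  FirstColumns : Cell (suc (suc m)) → Set
  FirstColumns z = (proj₂ z ≡ Fin.zero) ⊎ (proj₂ z ≡ Fin.suc Fin.zero)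
  classify : ∀ z → Image (shift ∘ shift) z ⊎ FirstColumns z
  classify (r , Fin.zero)           = inj₂ (inj₁ refl)
  classify (r , Fin.suc Fin.zero)   = inj₂ (inj₂ refl)
  classify (r , Fin.suc (Fin.suc c)) = inj₁ ((r , c) , refl)
  first-columns-closed : ∀ z → FirstColumns z → FirstColumns (mate T z)
  first-columns-closed (Fin.zero         , Fin.zero)         _ = inj₂ refl
  first-columns-closed (Fin.suc Fin.zero , Fin.zero)         _ = inj₂ refl
  first-columns-closed (Fin.zero         , Fin.suc Fin.zero) _ = inj₁ (cong proj₂ t₁≡)
  first-columns-closed (Fin.suc Fin.zero , Fin.suc Fin.zero) _ = inj₁ (cong proj₂ b₁≡)
  first-columns-closed (_ , Fin.suc (Fin.suc _)) (inj₁ ())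
  first-columns-closed (_ , Fin.suc (Fin.suc _)) (inj₂ ())
  mates-shifted : ∀ x → Image (shift ∘ shift) (mate T (shift (shift x)))
  mates-shifted = image-closed (shift ∘ shift) FirstColumns (mate T) classify
                    (λ { _ (inj₁ ()) ; _ (inj₂ ()) }) first-columns-closed (λ z → involutive (tiling z))
  top-row : Σ (Vec (Cell m) m) λ u → V.map (shift ∘ shift) u ≡ t
  top-row = preimage (shift ∘ shift) t (λ i → mates-shifted (top , i))
  bottom-row : Σ (Vec (Cell m) m) λ u → V.map (shift ∘ shift) u ≡ b
  bottom-row = preimage (shift ∘ shift) b (λ i → mates-shifted (bottom , i))
  T' : CellPairing m
  T' = proj₁ top-row , proj₁ bottom-row
  T'-extends : addHorizontals T' ≡ T
  T'-extends = cong₂ _,_ (cong ((top , Fin.suc Fin.zero) ∷_) (cong₂ _∷_ (sym t₁≡) (proj₂ top-row)))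
                         (cong ((bottom , Fin.suc Fin.zero) ∷_) (cong₂ _∷_ (sym b₁≡) (proj₂ bottom-row)))
  tiling' : IsTiling (addHorizontals T')
  tiling' = subst IsTiling (sym T'-extends) tiling

-- Every tiling is the tiling of a composition: the cell in the top-left
-- corner is covered by a vertical or by a horizontal domino, and in the
-- second case so is the cell below it.
decode-tiling : ∀ m (T : CellPairing m) → IsTiling T → Σ (Comp m) λ c → tilingOf c ≡ T
decode-tiling zero ([] , []) tiling = done , refl
decode-tiling (suc m) (((Fin.suc Fin.zero , Fin.zero) ∷ t) , (b₀ ∷ b)) tiling =
  let (T' , tiling' , T'-extends) = peel-vertical t b b₀ tiling
      (c , c-encodes) = decode-tiling m T' tiling'
  in one c , trans (cong addVertical c-encodes) T'-extends
decode-tiling (suc (suc m)) (((Fin.zero , Fin.suc Fin.zero) ∷ t₁ ∷ t) , ((Fin.suc Fin.zero , Fin.suc Fin.zero) ∷ b₁ ∷ b)) tiling =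
  let (T' , tiling' , T'-extends) = peel-horizontals t b t₁ b₁ tiling
      (c , c-encodes) = decode-tiling m T' tiling'
  in two c , trans (cong addHorizontals c-encodes) T'-extends
-- the remaining positions of the mates of the two cells of the first column
-- violate a tiling condition
decode-tiling (suc m) (((Fin.zero , Fin.zero) ∷ t) , _) tiling =
  ⊥-elim (moved (tiling (top , Fin.zero)) refl)
decode-tiling (suc m) (((Fin.zero , Fin.suc (Fin.suc _)) ∷ t) , _) tiling =
  ⊥-elim (false≢true (neighbour (tiling (top , Fin.zero))))
decode-tiling (suc m) (((Fin.suc Fin.zero , Fin.suc _) ∷ t) , _) tiling =
  ⊥-elim (false≢true (neighbour (tiling (top , Fin.zero))))
decode-tiling (suc (suc m)) (((Fin.zero , Fin.suc Fin.zero) ∷ _) , ((Fin.zero , Fin.zero) ∷ _)) tiling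
  with involutive (tiling (bottom , Fin.zero))
... | ()
decode-tiling (suc (suc m)) (((Fin.zero , Fin.suc Fin.zero) ∷ _) , ((Fin.zero , Fin.suc _) ∷ _)) tiling =
  ⊥-elim (false≢true (neighbour (tiling (bottom , Fin.zero))))
decode-tiling (suc (suc m)) (((Fin.zero , Fin.suc Fin.zero) ∷ _) , ((Fin.suc Fin.zero , Fin.zero) ∷ _)) tiling =
  ⊥-elim (moved (tiling (bottom , Fin.zero)) refl)
decode-tiling (suc (suc m)) (((Fin.zero , Fin.suc Fin.zero) ∷ _) , ((Fin.suc Fin.zero , Fin.suc (Fin.suc _)) ∷ _)) tiling =
  ⊥-elim (false≢true (neighbour (tiling (bottom , Fin.zero))))

verticalAt : ∀ {m} → CellPairing m → Fin m → Bool
verticalAt T c = toℕ (proj₂ (mate T (top , c))) ≡ᵇ toℕ c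

verticalAt-addVertical : ∀ {m} (T : CellPairing m) i → verticalAt (addVertical T) (Fin.suc i) ≡ verticalAt T i
verticalAt-addVertical T i = cong (λ y → toℕ (proj₂ y) ≡ᵇ toℕ (Fin.suc i)) (mate-addVertical T (top , i))

verticalAt-addHorizontals : ∀ {m} (T : CellPairing m) i →
  verticalAt (addHorizontals T) (Fin.suc (Fin.suc i)) ≡ verticalAt T i
verticalAt-addHorizontals T i =
  cong (λ y → toℕ (proj₂ y) ≡ᵇ toℕ (Fin.suc (Fin.suc i))) (mate-addHorizontals T (top , i))

∑-verticalAt : ∀ {m} (T : CellPairing m) (f : Fin m → Bool) → (∀ i → f i ≡ verticalAt T i) →
  ∑ (allFin m) (𝟙 ∘ f) ≡ verticals T
∑-verticalAt {m} T f f≡ = trans (∑-cong (allFin m) (cong 𝟙 ∘ f≡)) (sym (count≡∑ (verticalAt T) (allFin m)))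

verticals-addVertical : ∀ {m} (T : CellPairing m) → verticals (addVertical T) ≡ suc (verticals T)
verticals-addVertical {m} T = begin
  verticals (addVertical T)
    ≡⟨ count≡∑ (verticalAt (addVertical T)) (allFin (suc m)) ⟩
  suc (∑ (tabulate Fin.suc) (𝟙 ∘ verticalAt (addVertical T)))
    ≡⟨ cong suc (∑-allFin-suc m (𝟙 ∘ verticalAt (addVertical T))) ⟩
  suc (∑ (allFin m) (λ i → 𝟙 (verticalAt (addVertical T) (Fin.suc i))))
    ≡⟨ cong suc (∑-verticalAt T _ (verticalAt-addVertical T)) ⟩
  suc (verticals T) ∎
  where open ≡-Reasoning

verticals-addHorizontals : ∀ {m} (T : CellPairing m) → verticals (addHorizontals T) ≡ verticals T
verticals-addHorizontals {m} T = begin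
  verticals (addHorizontals T)
    ≡⟨ count≡∑ (verticalAt (addHorizontals T)) (allFin (suc (suc m))) ⟩
  ∑ (tabulate Fin.suc) (𝟙 ∘ verticalAt (addHorizontals T))
    ≡⟨ ∑-allFin-suc (suc m) (𝟙 ∘ verticalAt (addHorizontals T)) ⟩
  ∑ (tabulate Fin.suc) (λ i → 𝟙 (verticalAt (addHorizontals T) (Fin.suc i)))
    ≡⟨ ∑-allFin-suc m (λ i → 𝟙 (verticalAt (addHorizontals T) (Fin.suc i))) ⟩
  ∑ (allFin m) (λ i → 𝟙 (verticalAt (addHorizontals T) (Fin.suc (Fin.suc i))))
    ≡⟨ ∑-verticalAt T _ (verticalAt-addHorizontals T) ⟩
  verticals T ∎
  where open ≡-Reasoning

verticals-tilingOf : ∀ {m} (c : Comp m) → verticals (tilingOf c) ≡ ones c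
verticals-tilingOf done    = refl
verticals-tilingOf (one c) = trans (verticals-addVertical (tilingOf c)) (cong suc (verticals-tilingOf c))
verticals-tilingOf (two c) = trans (verticals-addHorizontals (tilingOf c)) (verticals-tilingOf c)

EqCellPairing : ∀ m → BoolEq (CellPairing m)
EqCellPairing m = Eq× (EqVec (EqCell m) m) (EqVec (EqCell m) m)

allCellPairings-listing : ∀ m → Listing (EqCellPairing m) (allCellPairings m)
allCellPairings-listing m =
  cartesian-listing (EqVec (EqCell m) m) (EqVec (EqCell m) m) (vecsOver (allCells m) m) (vecsOver (allCells m) m)
    rows rows
  where
  rows : Listing (EqVec (EqCell m) m) (vecsOver (allCells m) m)
  rows = vecsOver-listing (EqCell m) (allCells m) (allCells-listing m) m

d≡balancedPairs : ∀ k n → d k n ≡ balancedPairs k n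
d≡balancedPairs k n = begin
  d k n
    ≡⟨ count≡∑ _ (cartesianProduct (tilings k) (tilings n)) ⟩
  ∑ (cartesianProduct (tilings k) (tilings n)) (𝟙 ∘ sameVerticals)
    ≡⟨ count-cartesian-filter validTiling validTiling sameVerticals (allCellPairings k) (allCellPairings n) ⟩
  ∑ (cartesianProduct (allCellPairings k) (allCellPairings n)) (𝟙 ∘ tilingPair)
    ≡⟨ count-by-bijection (Eq× (EqCellPairing k) (EqCellPairing n)) (Eq× (EqComp k) (EqComp n))
         (cartesianProduct (allCellPairings k) (allCellPairings n)) (cartesianProduct (comps k) (comps n))
         (cartesian-listing (EqCellPairing k) (EqCellPairing n) (allCellPairings k) (allCellPairings n)
            (allCellPairings-listing k) (allCellPairings-listing n))
         (comp-pairs-listing k n) tilingPair balanced encode into onto inj ⟩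
  balancedPairs k n ∎
  where
  open ≡-Reasoning
  sameVerticals : CellPairing k × CellPairing n → Bool
  sameVerticals (T₁ , T₂) = verticals T₁ ≡ᵇ verticals T₂
  tilingPair : CellPairing k × CellPairing n → Bool
  tilingPair (T₁ , T₂) = validTiling T₁ ∧ validTiling T₂ ∧ sameVerticals (T₁ , T₂)
  encode : Comp k × Comp n → CellPairing k × CellPairing n
  encode (c₁ , c₂) = tilingOf c₁ , tilingOf c₂
  into : ∀ c → balanced c ≡ true → tilingPair (encode c) ≡ true
  into (c₁ , c₂) bal rewrite IsTiling⇒validTiling (tilingOf c₁) (tilingOf-tiling c₁)
    | IsTiling⇒validTiling (tilingOf c₂) (tilingOf-tiling c₂)
    | verticals-tilingOf c₁ | verticals-tilingOf c₂ = bal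
  onto : ∀ T → tilingPair T ≡ true → Σ (Comp k × Comp n) λ c → balanced c ≡ true × encode c ≡ T
  onto (T₁ , T₂) valid with ∧-true valid
  ... | valid₁ , rest with ∧-true rest
  ... | valid₂ , same with decode-tiling k T₁ (validTiling⇒IsTiling T₁ valid₁)
                        | decode-tiling n T₂ (validTiling⇒IsTiling T₂ valid₂)
  ... | c₁ , refl | c₂ , refl rewrite verticals-tilingOf c₁ | verticals-tilingOf c₂ = (c₁ , c₂) , same , refl
  inj : ∀ c c' → balanced c ≡ true → balanced c' ≡ true → encode c ≡ encode c' → c ≡ c'
  inj (c₁ , c₂) (c₁' , c₂') _ _ e =
    cong₂ _,_ (tilingOf-injective c₁ c₁' (cong proj₁ e)) (tilingOf-injective c₂ c₂' (cong proj₂ e))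

-- Non-crossing matchings of points on two parallel lines

shift₁ : ∀ {k n} → Point k n → Point (suc k) n
shift₁ (inj₁ i) = inj₁ (Fin.suc i)
shift₁ (inj₂ j) = inj₂ j

shift₂ : ∀ {k n} → Point k n → Point k (suc n)
shift₂ (inj₁ i) = inj₁ i
shift₂ (inj₂ j) = inj₂ (Fin.suc j)

shift₁-injective : ∀ {k n} {x y : Point k n} → shift₁ x ≡ shift₁ y → x ≡ y
shift₁-injective {x = inj₁ _} {inj₁ _} refl = refl
shift₁-injective {x = inj₂ _} {inj₂ _} refl = refl

shift₂-injective : ∀ {k n} {x y : Point k n} → shift₂ x ≡ shift₂ y → x ≡ y
shift₂-injective {x = inj₁ _} {inj₁ _} refl = refl
shift₂-injective {x = inj₂ _} {inj₂ _} refl = refl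

≤ᵇ-suc : ∀ a b → (suc a ≤ᵇ suc b) ≡ (a ≤ᵇ b)
≤ᵇ-suc zero    b = refl
≤ᵇ-suc (suc a) b = refl

overlaps : ℕ → ℕ → ℕ → ℕ → Bool
overlaps a b c e = (a ⊓ b) ⊔ (c ⊓ e) ≤ᵇ (a ⊔ b) ⊓ (c ⊔ e)

overlaps-suc : ∀ a b c e → overlaps (suc a) (suc b) (suc c) (suc e) ≡ overlaps a b c e
overlaps-suc a b c e = ≤ᵇ-suc ((a ⊓ b) ⊔ (c ⊓ e)) ((a ⊔ b) ⊓ (c ⊔ e))

between-suc : ∀ x a b → between (suc x) (suc a) (suc b) ≡ between x a b
between-suc x a b = cong₂ _∧_ (≤ᵇ-suc (a ⊓ b) x) (≤ᵇ-suc x (a ⊔ b))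

-- the segments from position a₁ on line 1 to a₂ on line 2 and from c₁ to c₂
-- intersect
crossing : ℕ → ℕ → ℕ → ℕ → Bool
crossing a₁ a₂ c₁ c₂ = ((a₁ ≤ᵇ c₁) ∧ (c₂ ≤ᵇ a₂)) ∨ ((c₁ ≤ᵇ a₁) ∧ (a₂ ≤ᵇ c₂))

crossing-suc₁ : ∀ a₁ a₂ c₁ c₂ → crossing (suc a₁) a₂ (suc c₁) c₂ ≡ crossing a₁ a₂ c₁ c₂
crossing-suc₁ a₁ a₂ c₁ c₂ = cong₂ (λ p q → (p ∧ (c₂ ≤ᵇ a₂)) ∨ (q ∧ (a₂ ≤ᵇ c₂))) (≤ᵇ-suc a₁ c₁) (≤ᵇ-suc c₁ a₁)

crossing-suc₂ : ∀ a₁ a₂ c₁ c₂ → crossing a₁ (suc a₂) c₁ (suc c₂) ≡ crossing a₁ a₂ c₁ c₂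
crossing-suc₂ a₁ a₂ c₁ c₂ = cong₂ (λ p q → ((a₁ ≤ᵇ c₁) ∧ p) ∨ ((c₁ ≤ᵇ a₁) ∧ q)) (≤ᵇ-suc c₂ a₂) (≤ᵇ-suc a₂ c₂)

meet-shift₁ : ∀ {k n} (u v u' v' : Point k n) →
  meet (shift₁ u) (shift₁ v) (shift₁ u') (shift₁ v') ≡ meet u v u' v'
meet-shift₁ (inj₁ a) (inj₁ b) (inj₁ c) (inj₁ e) = overlaps-suc (toℕ a) (toℕ b) (toℕ c) (toℕ e)
meet-shift₁ (inj₁ a) (inj₁ b) (inj₁ c) (inj₂ e) = between-suc (toℕ c) (toℕ a) (toℕ b)
meet-shift₁ (inj₁ a) (inj₁ b) (inj₂ c) (inj₁ e) = between-suc (toℕ e) (toℕ a) (toℕ b)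
meet-shift₁ (inj₁ a) (inj₁ b) (inj₂ c) (inj₂ e) = refl
meet-shift₁ (inj₁ a) (inj₂ b) (inj₁ c) (inj₁ e) = between-suc (toℕ a) (toℕ c) (toℕ e)
meet-shift₁ (inj₁ a) (inj₂ b) (inj₁ c) (inj₂ e) = crossing-suc₁ (toℕ a) (toℕ b) (toℕ c) (toℕ e)
meet-shift₁ (inj₁ a) (inj₂ b) (inj₂ c) (inj₁ e) = crossing-suc₁ (toℕ a) (toℕ b) (toℕ e) (toℕ c)
meet-shift₁ (inj₁ a) (inj₂ b) (inj₂ c) (inj₂ e) = refl
meet-shift₁ (inj₂ a) (inj₁ b) (inj₁ c) (inj₁ e) = between-suc (toℕ b) (toℕ c) (toℕ e)
meet-shift₁ (inj₂ a) (inj₁ b) (inj₁ c) (inj₂ e) = crossing-suc₁ (toℕ b) (toℕ a) (toℕ c) (toℕ e)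
meet-shift₁ (inj₂ a) (inj₁ b) (inj₂ c) (inj₁ e) = crossing-suc₁ (toℕ b) (toℕ a) (toℕ e) (toℕ c)
meet-shift₁ (inj₂ a) (inj₁ b) (inj₂ c) (inj₂ e) = refl
meet-shift₁ (inj₂ a) (inj₂ b) (inj₁ c) (inj₁ e) = refl
meet-shift₁ (inj₂ a) (inj₂ b) (inj₁ c) (inj₂ e) = refl
meet-shift₁ (inj₂ a) (inj₂ b) (inj₂ c) (inj₁ e) = refl
meet-shift₁ (inj₂ a) (inj₂ b) (inj₂ c) (inj₂ e) = refl

meet-shift₂ : ∀ {k n} (u v u' v' : Point k n) →
  meet (shift₂ u) (shift₂ v) (shift₂ u') (shift₂ v') ≡ meet u v u' v'
meet-shift₂ (inj₁ a) (inj₁ b) (inj₁ c) (inj₁ e) = refl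
meet-shift₂ (inj₁ a) (inj₁ b) (inj₁ c) (inj₂ e) = refl
meet-shift₂ (inj₁ a) (inj₁ b) (inj₂ c) (inj₁ e) = refl
meet-shift₂ (inj₁ a) (inj₁ b) (inj₂ c) (inj₂ e) = refl
meet-shift₂ (inj₁ a) (inj₂ b) (inj₁ c) (inj₁ e) = refl
meet-shift₂ (inj₁ a) (inj₂ b) (inj₁ c) (inj₂ e) = crossing-suc₂ (toℕ a) (toℕ b) (toℕ c) (toℕ e)
meet-shift₂ (inj₁ a) (inj₂ b) (inj₂ c) (inj₁ e) = crossing-suc₂ (toℕ a) (toℕ b) (toℕ e) (toℕ c)
meet-shift₂ (inj₁ a) (inj₂ b) (inj₂ c) (inj₂ e) = between-suc (toℕ b) (toℕ c) (toℕ e)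
meet-shift₂ (inj₂ a) (inj₁ b) (inj₁ c) (inj₁ e) = refl
meet-shift₂ (inj₂ a) (inj₁ b) (inj₁ c) (inj₂ e) = crossing-suc₂ (toℕ b) (toℕ a) (toℕ c) (toℕ e)
meet-shift₂ (inj₂ a) (inj₁ b) (inj₂ c) (inj₁ e) = crossing-suc₂ (toℕ b) (toℕ a) (toℕ e) (toℕ c)
meet-shift₂ (inj₂ a) (inj₁ b) (inj₂ c) (inj₂ e) = between-suc (toℕ a) (toℕ c) (toℕ e)
meet-shift₂ (inj₂ a) (inj₂ b) (inj₁ c) (inj₁ e) = refl
meet-shift₂ (inj₂ a) (inj₂ b) (inj₁ c) (inj₂ e) = between-suc (toℕ e) (toℕ a) (toℕ b)
meet-shift₂ (inj₂ a) (inj₂ b) (inj₂ c) (inj₁ e) = between-suc (toℕ c) (toℕ a) (toℕ b)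
meet-shift₂ (inj₂ a) (inj₂ b) (inj₂ c) (inj₂ e) = overlaps-suc (toℕ a) (toℕ b) (toℕ c) (toℕ e)

record MatchedAt {k n : ℕ} (P : Pairing k n) (x : Point k n) : Set where
  field
    involution   : partner P (partner P x) ≡ x
    no-loop      : partner P x ≢ x
    non-crossing : ∀ y → y ≢ x → y ≢ partner P x → meet x (partner P x) y (partner P y) ≡ false
open MatchedAt

IsMatching : ∀ {k n} → Pairing k n → Set
IsMatching P = ∀ x → MatchedAt P x

validPairing⇒IsMatching : ∀ {k n} (P : Pairing k n) → validPairing P ≡ true → IsMatching P
validPairing⇒IsMatching {k} {n} P valid x = record
  { involution   = sound (EqPoint k n) _ _ (proj₁ at-x)
  ; no-loop      = eq-false⇒≢ (EqPoint k n) (not-true (proj₁ (∧-true (proj₂ at-x))))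
  ; non-crossing = λ y y≢x y≢x' → apart y (at y (allPoints-listing k n y)) y≢x y≢x' }
  where
  everywhere : {f : Point k n → Bool} → allᵇ f (allPoints k n) ≡ true →
    ∀ z → ∑ (allPoints k n) (λ w → 𝟙 (w ≟ᵖ z)) ≡ 1 → f z ≡ true
  everywhere {f} = allᵇ-elim (EqPoint k n) f (allPoints k n)
  at-x : (partner P (partner P x) ≟ᵖ x) ≡ true ×
         (not (partner P x ≟ᵖ x) ∧ allᵇ (λ y → (y ≟ᵖ x) ∨ (y ≟ᵖ partner P x) ∨
                                       not (meet x (partner P x) y (partner P y))) (allPoints k n)) ≡ true
  at-x = ∧-true (everywhere valid x (allPoints-listing k n x))
  at : ∀ y → ∑ (allPoints k n) (λ w → 𝟙 (w ≟ᵖ y)) ≡ 1 →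
       ((y ≟ᵖ x) ∨ (y ≟ᵖ partner P x) ∨ not (meet x (partner P x) y (partner P y))) ≡ true
  at = everywhere (proj₂ (∧-true (proj₂ at-x)))
  apart : ∀ y → ((y ≟ᵖ x) ∨ (y ≟ᵖ partner P x) ∨ not (meet x (partner P x) y (partner P y))) ≡ true →
          y ≢ x → y ≢ partner P x → meet x (partner P x) y (partner P y) ≡ false
  apart y e y≢x y≢x' with y ≟ᵖ x in e₁ | y ≟ᵖ partner P x in e₂
  ... | true  | _     = ⊥-elim (y≢x (sound (EqPoint k n) _ _ e₁))
  ... | false | true  = ⊥-elim (y≢x' (sound (EqPoint k n) _ _ e₂))
  ... | false | false = not-true e

IsMatching⇒validPairing : ∀ {k n} (P : Pairing k n) → IsMatching P → validPairing P ≡ true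
IsMatching⇒validPairing {k} {n} P matching = allᵇ-intro _ (allPoints k n) at
  where
  at : ∀ x → ((partner P (partner P x) ≟ᵖ x) ∧ not (partner P x ≟ᵖ x) ∧
              allᵇ (λ y → (y ≟ᵖ x) ∨ (y ≟ᵖ partner P x) ∨ not (meet x (partner P x) y (partner P y)))
                   (allPoints k n)) ≡ true
  at x rewrite involution (matching x) | reflexive (EqPoint k n) x with partner P x ≟ᵖ x in e
  ... | true  = ⊥-elim (no-loop (matching x) (sound (EqPoint k n) _ _ e))
  ... | false = allᵇ-intro _ (allPoints k n) apart
    where
    apart : ∀ y → ((y ≟ᵖ x) ∨ (y ≟ᵖ partner P x) ∨ not (meet x (partner P x) y (partner P y))) ≡ true
    apart y with y ≟ᵖ x in e₁
    ... | true = refl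
    ... | false with y ≟ᵖ partner P x in e₂
    ... | true = refl
    ... | false rewrite non-crossing (matching x) y (eq-false⇒≢ (EqPoint k n) e₁) (eq-false⇒≢ (EqPoint k n) e₂) = refl

Disjoint : ∀ {k n} → Point k n → Point k n → Point k n → Point k n → Set
Disjoint z₀ z₁ u v =
  meet z₀ z₁ u v ≡ false × meet z₁ z₀ u v ≡ false × meet u v z₀ z₁ ≡ false × meet u v z₁ z₀ ≡ false

module ShiftedMatching {k n k' n' : ℕ} (s : Point k n → Point k' n') (s-inj : ∀ {x y} → s x ≡ s y → x ≡ y)
  (s-meet : ∀ u v u' v' → meet (s u) (s v) (s u') (s v') ≡ meet u v u' v')
  (P : Pairing k n) (P' : Pairing k' n') (commute : ∀ x → partner P' (s x) ≡ s (partner P x)) where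

  segment-shift : ∀ x y →
    meet (s x) (partner P' (s x)) (s y) (partner P' (s y)) ≡ meet x (partner P x) y (partner P y)
  segment-shift x y = trans (cong₂ (λ p q → meet (s x) p (s y) q) (commute x) (commute y)) (s-meet _ _ _ _)

  backward : ∀ x → MatchedAt P' (s x) → MatchedAt P x
  backward x at = record
    { involution   = s-inj (trans (sym (commute _)) (trans (cong (partner P') (sym (commute x))) (involution at)))
    ; no-loop      = λ e → no-loop at (trans (commute x) (cong s e))
    ; non-crossing = λ y y≢x y≢x' → trans (sym (segment-shift x y))
        (non-crossing at (s y) (λ e → y≢x (s-inj e)) (λ e → y≢x' (s-inj (trans e (commute x))))) }

  forward-old : ∀ x → MatchedAt P x → (∀ y → Image s y ⊎ (∀ w → meet (s x) (s w) y (partner P' y) ≡ false)) →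
    MatchedAt P' (s x)
  forward-old x at classify = record
    { involution   = trans (cong (partner P') (commute x)) (trans (commute _) (cong s (involution at)))
    ; no-loop      = λ e → no-loop at (s-inj (trans (sym (commute x)) e))
    ; non-crossing = λ y y≢sx y≢sx' → apart y y≢sx y≢sx' (classify y) }
    where
    apart : ∀ y → y ≢ s x → y ≢ partner P' (s x) → Image s y ⊎ (∀ w → meet (s x) (s w) y (partner P' y) ≡ false) →
            meet (s x) (partner P' (s x)) y (partner P' y) ≡ false
    apart .(s w) w≢x w≢x' (inj₁ (w , refl)) = trans (segment-shift x w)
      (non-crossing at w (λ e → w≢x (cong s e)) (λ e → w≢x' (trans (cong s e) (sym (commute x)))))
    apart y _ _ (inj₂ new) = trans (cong (λ p → meet (s x) p y (partner P' y)) (commute x)) (new (partner P x))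

  forward-new : (z z' : Point k' n') → partner P' z ≡ z' → partner P' z' ≡ z → z ≢ z' →
    (∀ x w → meet z z' (s x) (s w) ≡ false) → (∀ y → Image s y ⊎ (y ≡ z ⊎ y ≡ z')) →
    MatchedAt P' z
  forward-new z z' to-z' to-z z≢z' apart classify = record
    { involution   = trans (cong (partner P') to-z') to-z
    ; no-loop      = λ e → z≢z' (trans (sym e) to-z')
    ; non-crossing = λ y y≢z y≢z' → at y y≢z y≢z' (classify y) }
    where
    at : ∀ y → y ≢ z → y ≢ partner P' z → Image s y ⊎ (y ≡ z ⊎ y ≡ z') →
         meet z (partner P' z) y (partner P' y) ≡ false
    at .(s w) _ _ (inj₁ (w , refl)) =
      trans (cong₂ (λ p q → meet z p (s w) q) to-z' (commute w)) (apart w (partner P w))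
    at y y≢z _    (inj₂ (inj₁ y≡z))  = ⊥-elim (y≢z y≡z)
    at y _ y≢z'   (inj₂ (inj₂ y≡z')) = ⊥-elim (y≢z' (trans y≡z' (sym to-z')))

  forward : (z₀ z₁ : Point k' n') → partner P' z₀ ≡ z₁ → partner P' z₁ ≡ z₀ → z₀ ≢ z₁ →
    (∀ z → Image s z ⊎ (z ≡ z₀ ⊎ z ≡ z₁)) →
    (∀ x w → Disjoint z₀ z₁ (s x) (s w)) → IsMatching P → IsMatching P'
  forward z₀ z₁ to-z₁ to-z₀ z₀≢z₁ classify disjoint matching z with classify z
  ... | inj₁ (x , refl) = forward-old x (matching x) (λ y → map₂ (apart-from y) (classify y))
    where
    apart-from : ∀ y → y ≡ z₀ ⊎ y ≡ z₁ → ∀ w → meet (s x) (s w) y (partner P' y) ≡ false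
    apart-from .z₀ (inj₁ refl) w = trans (cong (meet (s x) (s w) z₀) to-z₁) (proj₁ (proj₂ (proj₂ (disjoint x w))))
    apart-from .z₁ (inj₂ refl) w = trans (cong (meet (s x) (s w) z₁) to-z₀) (proj₂ (proj₂ (proj₂ (disjoint x w))))
  ... | inj₂ (inj₁ refl) =
    forward-new z₀ z₁ to-z₁ to-z₀ z₀≢z₁ (λ x w → proj₁ (disjoint x w)) classify
  ... | inj₂ (inj₂ refl) =
    forward-new z₁ z₀ to-z₀ to-z₁ (λ e → z₀≢z₁ (sym e)) (λ x w → proj₁ (proj₂ (disjoint x w)))
      (λ y → map₂ swap (classify y))

skip₁ : ∀ {k n} → Point k n → Point (suc (suc k)) n
skip₁ = shift₁ ∘ shift₁

skip₂ : ∀ {k n} → Point k n → Point k (suc (suc n))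
skip₂ = shift₂ ∘ shift₂

skip₁₂ : ∀ {k n} → Point k n → Point (suc k) (suc n)
skip₁₂ = shift₁ ∘ shift₂

meet-skip₁ : ∀ {k n} (u v u' v' : Point k n) → meet (skip₁ u) (skip₁ v) (skip₁ u') (skip₁ v') ≡ meet u v u' v'
meet-skip₁ u v u' v' = trans (meet-shift₁ (shift₁ u) (shift₁ v) (shift₁ u') (shift₁ v')) (meet-shift₁ u v u' v')

meet-skip₂ : ∀ {k n} (u v u' v' : Point k n) → meet (skip₂ u) (skip₂ v) (skip₂ u') (skip₂ v') ≡ meet u v u' v'
meet-skip₂ u v u' v' = trans (meet-shift₂ (shift₂ u) (shift₂ v) (shift₂ u') (shift₂ v')) (meet-shift₂ u v u' v')

meet-skip₁₂ : ∀ {k n} (u v u' v' : Point k n) → meet (skip₁₂ u) (skip₁₂ v) (skip₁₂ u') (skip₁₂ v') ≡ meet u v u' v'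
meet-skip₁₂ u v u' v' = trans (meet-shift₁ (shift₂ u) (shift₂ v) (shift₂ u') (shift₂ v')) (meet-shift₂ u v u' v')

addArc₁ : ∀ {k n} → Pairing k n → Pairing (suc (suc k)) n
addArc₁ (v₁ , v₂) = (inj₁ (Fin.suc Fin.zero) ∷ inj₁ Fin.zero ∷ V.map skip₁ v₁) , V.map skip₁ v₂

addArc₂ : ∀ {k n} → Pairing k n → Pairing k (suc (suc n))
addArc₂ (v₁ , v₂) = V.map skip₂ v₁ , (inj₂ (Fin.suc Fin.zero) ∷ inj₂ Fin.zero ∷ V.map skip₂ v₂)

addRung : ∀ {k n} → Pairing k n → Pairing (suc k) (suc n)
addRung (v₁ , v₂) = (inj₂ Fin.zero ∷ V.map skip₁₂ v₁) , (inj₁ Fin.zero ∷ V.map skip₁₂ v₂)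

partner-addArc₁ : ∀ {k n} (P : Pairing k n) x → partner (addArc₁ P) (skip₁ x) ≡ skip₁ (partner P x)
partner-addArc₁ (v₁ , v₂) (inj₁ i) = lookup-map i skip₁ v₁
partner-addArc₁ (v₁ , v₂) (inj₂ j) = lookup-map j skip₁ v₂

partner-addArc₂ : ∀ {k n} (P : Pairing k n) x → partner (addArc₂ P) (skip₂ x) ≡ skip₂ (partner P x)
partner-addArc₂ (v₁ , v₂) (inj₁ i) = lookup-map i skip₂ v₁
partner-addArc₂ (v₁ , v₂) (inj₂ j) = lookup-map j skip₂ v₂

partner-addRung : ∀ {k n} (P : Pairing k n) x → partner (addRung P) (skip₁₂ x) ≡ skip₁₂ (partner P x)
partner-addRung (v₁ , v₂) (inj₁ i) = lookup-map i skip₁₂ v₁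
partner-addRung (v₁ , v₂) (inj₂ j) = lookup-map j skip₁₂ v₂

classify-arc₁ : ∀ {k n} (z : Point (suc (suc k)) n) →
  Image skip₁ z ⊎ (z ≡ inj₁ Fin.zero ⊎ z ≡ inj₁ (Fin.suc Fin.zero))
classify-arc₁ (inj₁ Fin.zero)                 = inj₂ (inj₁ refl)
classify-arc₁ (inj₁ (Fin.suc Fin.zero))       = inj₂ (inj₂ refl)
classify-arc₁ (inj₁ (Fin.suc (Fin.suc i)))    = inj₁ (inj₁ i , refl)
classify-arc₁ (inj₂ j)                        = inj₁ (inj₂ j , refl)

classify-arc₂ : ∀ {k n} (z : Point k (suc (suc n))) →
  Image skip₂ z ⊎ (z ≡ inj₂ Fin.zero ⊎ z ≡ inj₂ (Fin.suc Fin.zero))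
classify-arc₂ (inj₂ Fin.zero)                 = inj₂ (inj₁ refl)
classify-arc₂ (inj₂ (Fin.suc Fin.zero))       = inj₂ (inj₂ refl)
classify-arc₂ (inj₂ (Fin.suc (Fin.suc j)))    = inj₁ (inj₂ j , refl)
classify-arc₂ (inj₁ i)                        = inj₁ (inj₁ i , refl)

classify-rung : ∀ {k n} (z : Point (suc k) (suc n)) →
  Image skip₁₂ z ⊎ (z ≡ inj₁ Fin.zero ⊎ z ≡ inj₂ Fin.zero)
classify-rung (inj₁ Fin.zero)    = inj₂ (inj₁ refl)
classify-rung (inj₂ Fin.zero)    = inj₂ (inj₂ refl)
classify-rung (inj₁ (Fin.suc i)) = inj₁ (inj₁ i , refl)
classify-rung (inj₂ (Fin.suc j)) = inj₁ (inj₂ j , refl)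

-- The new segment lies to the left of all old ones.
disjoint-arc₁ : ∀ {k n} (x w : Point k n) → Disjoint (inj₁ Fin.zero) (inj₁ (Fin.suc Fin.zero)) (skip₁ x) (skip₁ w)
disjoint-arc₁ (inj₁ _) (inj₁ _) = refl , refl , refl , refl
disjoint-arc₁ (inj₁ _) (inj₂ _) = refl , refl , refl , refl
disjoint-arc₁ (inj₂ _) (inj₁ _) = refl , refl , refl , refl
disjoint-arc₁ (inj₂ _) (inj₂ _) = refl , refl , refl , refl

disjoint-arc₂ : ∀ {k n} (x w : Point k n) → Disjoint (inj₂ Fin.zero) (inj₂ (Fin.suc Fin.zero)) (skip₂ x) (skip₂ w)
disjoint-arc₂ (inj₁ _) (inj₁ _) = refl , refl , refl , refl
disjoint-arc₂ (inj₁ _) (inj₂ _) = refl , refl , refl , refl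
disjoint-arc₂ (inj₂ _) (inj₁ _) = refl , refl , refl , refl
disjoint-arc₂ (inj₂ _) (inj₂ _) = refl , refl , refl , refl

disjoint-rung : ∀ {k n} (x w : Point k n) → Disjoint (inj₁ Fin.zero) (inj₂ Fin.zero) (skip₁₂ x) (skip₁₂ w)
disjoint-rung (inj₁ _) (inj₁ _) = refl , refl , refl , refl
disjoint-rung (inj₁ _) (inj₂ _) = refl , refl , refl , refl
disjoint-rung (inj₂ _) (inj₁ _) = refl , refl , refl , refl
disjoint-rung (inj₂ _) (inj₂ _) = refl , refl , refl , refl

record Extension (k n k' n' : ℕ) : Set where
  field
    embed           : Point k n → Point k' n'
    embed-injective : ∀ {x y} → embed x ≡ embed y → x ≡ y
    embed-meet      : ∀ u v u' v' → meet (embed u) (embed v) (embed u') (embed v') ≡ meet u v u' v'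
    extend          : Pairing k n → Pairing k' n'
    extend-partner  : ∀ P x → partner (extend P) (embed x) ≡ embed (partner P x)
    new₀ new₁       : Point k' n'
    new₀≢new₁       : new₀ ≢ new₁
    extend-new₀     : ∀ P → partner (extend P) new₀ ≡ new₁
    extend-new₁     : ∀ P → partner (extend P) new₁ ≡ new₀
    classify        : ∀ z → Image embed z ⊎ (z ≡ new₀ ⊎ z ≡ new₁)
    embed-old       : ∀ x → embed x ≡ new₀ ⊎ embed x ≡ new₁ → ⊥
    disjoint        : ∀ x w → Disjoint new₀ new₁ (embed x) (embed w)

arc₁ : ∀ {k n} → Extension k n (suc (suc k)) n
arc₁ = record
  { embed = skip₁ ; embed-injective = shift₁-injective ∘ shift₁-injective ; embed-meet = meet-skip₁
  ; extend = addArc₁ ; extend-partner = partner-addArc₁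
  ; new₀ = inj₁ Fin.zero ; new₁ = inj₁ (Fin.suc Fin.zero) ; new₀≢new₁ = λ ()
  ; extend-new₀ = λ _ → refl ; extend-new₁ = λ _ → refl
  ; classify = classify-arc₁
  ; embed-old = λ { (inj₁ _) (inj₁ ()) ; (inj₁ _) (inj₂ ()) ; (inj₂ _) (inj₁ ()) ; (inj₂ _) (inj₂ ()) }
  ; disjoint = disjoint-arc₁ }

arc₂ : ∀ {k n} → Extension k n k (suc (suc n))
arc₂ = record
  { embed = skip₂ ; embed-injective = shift₂-injective ∘ shift₂-injective ; embed-meet = meet-skip₂
  ; extend = addArc₂ ; extend-partner = partner-addArc₂
  ; new₀ = inj₂ Fin.zero ; new₁ = inj₂ (Fin.suc Fin.zero) ; new₀≢new₁ = λ ()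
  ; extend-new₀ = λ _ → refl ; extend-new₁ = λ _ → refl
  ; classify = classify-arc₂
  ; embed-old = λ { (inj₁ _) (inj₁ ()) ; (inj₁ _) (inj₂ ()) ; (inj₂ _) (inj₁ ()) ; (inj₂ _) (inj₂ ()) }
  ; disjoint = disjoint-arc₂ }

rung : ∀ {k n} → Extension k n (suc k) (suc n)
rung = record
  { embed = skip₁₂ ; embed-injective = shift₂-injective ∘ shift₁-injective ; embed-meet = meet-skip₁₂
  ; extend = addRung ; extend-partner = partner-addRung
  ; new₀ = inj₁ Fin.zero ; new₁ = inj₂ Fin.zero ; new₀≢new₁ = λ ()
  ; extend-new₀ = λ _ → refl ; extend-new₁ = λ _ → refl
  ; classify = classify-rung
  ; embed-old = λ { (inj₁ _) (inj₁ ()) ; (inj₁ _) (inj₂ ()) ; (inj₂ _) (inj₁ ()) ; (inj₂ _) (inj₂ ()) }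
  ; disjoint = disjoint-rung }

pairing-ext : ∀ {k n} (P Q : Pairing k n) → (∀ z → partner P z ≡ partner Q z) → P ≡ Q
pairing-ext (v₁ , v₂) (w₁ , w₂) h = cong₂ _,_ (vec-ext v₁ w₁ (h ∘ inj₁)) (vec-ext v₂ w₂ (h ∘ inj₂))

module _ {k n k' n' : ℕ} (E : Extension k n k' n') where
  open Extension E

  extend-matching : (P : Pairing k n) → IsMatching P → IsMatching (extend P)
  extend-matching P = ShiftedMatching.forward embed embed-injective embed-meet P (extend P) (extend-partner P)
    new₀ new₁ (extend-new₀ P) (extend-new₁ P) new₀≢new₁ classify disjoint

  extend-injective : (P Q : Pairing k n) → extend P ≡ extend Q → P ≡ Q
  extend-injective P Q e = pairing-ext P Q (λ x → embed-injective
    (trans (sym (extend-partner P x)) (trans (cong (λ R → partner R (embed x)) e) (extend-partner Q x))))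

  restrict : (P' : Pairing k' n') → IsMatching P' → partner P' new₀ ≡ new₁ →
    Σ (Pairing k n) λ P → IsMatching P × extend P ≡ P'
  restrict P' matching to-new₁ = P , (λ x → ShiftedMatching.backward embed embed-injective embed-meet
      P (extend P) (extend-partner P) x (subst IsMatching (sym extends) matching (embed x))) , extends
    where
    New : Point k' n' → Set
    New z = z ≡ new₀ ⊎ z ≡ new₁
    to-new₀ : partner P' new₁ ≡ new₀
    to-new₀ = trans (cong (partner P') (sym to-new₁)) (involution (matching new₀))
    new-closed : ∀ z → New z → New (partner P' z)
    new-closed z (inj₁ refl) = inj₂ to-new₁
    new-closed z (inj₂ refl) = inj₁ to-new₀
    mates : ∀ x → Image embed (partner P' (embed x))
    mates = image-closed embed New (partner P') classify embed-old new-closed (λ z → involution (matching z))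
    P : Pairing k n
    P = V.tabulate (λ i → proj₁ (mates (inj₁ i))) , V.tabulate (λ j → proj₁ (mates (inj₂ j)))
    partner-P : ∀ x → partner P x ≡ proj₁ (mates x)
    partner-P (inj₁ i) = lookup∘tabulate (λ i → proj₁ (mates (inj₁ i))) i
    partner-P (inj₂ j) = lookup∘tabulate (λ j → proj₁ (mates (inj₂ j))) j
    agree : ∀ z → Image embed z ⊎ New z → partner (extend P) z ≡ partner P' z
    agree .(embed x) (inj₁ (x , refl)) =
      trans (extend-partner P x) (trans (cong embed (partner-P x)) (proj₂ (mates x)))
    agree z (inj₂ (inj₁ refl)) = trans (extend-new₀ P) (sym to-new₁)
    agree z (inj₂ (inj₂ refl)) = trans (extend-new₁ P) (sym to-new₀)
    extends : extend P ≡ P'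
    extends = pairing-ext (extend P) P' (λ z → agree z (classify z))

-- Every point is its own partner; this is not a matching and only serves as
-- the value of matchingOf on pairs of compositions with different numbers
-- of ones, which are never used.
selfPairing : ∀ {k n} → Pairing k n
selfPairing = V.tabulate inj₁ , V.tabulate inj₂

matchingOf : ∀ {k n} → Comp k → Comp n → Pairing k n
matchingOf (two a) b       = addArc₁ (matchingOf a b)
matchingOf done    (two b) = addArc₂ (matchingOf done b)
matchingOf (one a) (two b) = addArc₂ (matchingOf (one a) b)
matchingOf (one a) (one b) = addRung (matchingOf a b)
matchingOf done    done    = [] , []
matchingOf done    (one b) = selfPairing
matchingOf (one a) done    = selfPairing

matchingOf-matching : ∀ {k n} (a : Comp k) (b : Comp n) → ones a ≡ ones b → IsMatching (matchingOf a b)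
matchingOf-matching (two a) b       bal = extend-matching arc₁ _ (matchingOf-matching a b bal)
matchingOf-matching done    (two b) bal = extend-matching arc₂ _ (matchingOf-matching done b bal)
matchingOf-matching (one a) (two b) bal = extend-matching arc₂ _ (matchingOf-matching (one a) b bal)
matchingOf-matching (one a) (one b) bal = extend-matching rung _ (matchingOf-matching a b (suc-injective bal))
matchingOf-matching done    done    bal (inj₁ ())
matchingOf-matching done    done    bal (inj₂ ())
matchingOf-matching done    (one b) ()
matchingOf-matching (one a) done    ()

addArcs-commute : ∀ {k n} (P : Pairing k n) → addArc₁ (addArc₂ P) ≡ addArc₂ (addArc₁ P)
addArcs-commute (v₁ , v₂) =
  cong₂ _,_ (cong (λ v → inj₁ (Fin.suc Fin.zero) ∷ inj₁ Fin.zero ∷ v) (skips-commute v₁))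
            (cong (λ v → inj₂ (Fin.suc Fin.zero) ∷ inj₂ Fin.zero ∷ v) (skips-commute v₂))
  where
  skip-commute : ∀ {k n} (x : Point k n) → skip₁ (skip₂ x) ≡ skip₂ (skip₁ x)
  skip-commute (inj₁ _) = refl
  skip-commute (inj₂ _) = refl
  skips-commute : ∀ {k n m} (v : Vec (Point k n) m) → V.map skip₁ (V.map skip₂ v) ≡ V.map skip₂ (V.map skip₁ v)
  skips-commute v = trans (sym (map-∘ skip₁ skip₂ v)) (trans (map-cong skip-commute v) (map-∘ skip₂ skip₁ v))

matchingOf-two₂ : ∀ {k n} (a : Comp k) (b : Comp n) → matchingOf a (two b) ≡ addArc₂ (matchingOf a b)
matchingOf-two₂ done    b = refl
matchingOf-two₂ (one a) b = refl
matchingOf-two₂ (two a) b = trans (cong addArc₁ (matchingOf-two₂ a b)) (addArcs-commute (matchingOf a b))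

leftmost-rung : ∀ {k n} (a : Comp k) (b : Comp n) → suc (ones a) ≡ ones b →
  Σ (Fin n) λ j → partner (matchingOf (one a) b) (inj₁ Fin.zero) ≡ inj₂ j
leftmost-rung a (one b) _   = Fin.zero , refl
leftmost-rung a (two b) bal =
  let (j , to-j) = leftmost-rung a b bal
  in Fin.suc (Fin.suc j) , trans (partner-addArc₂ (matchingOf (one a) b) (inj₁ Fin.zero)) (cong skip₂ to-j)

-- On balanced pairs, the blocks are recovered from the partners of the
-- leftmost points.
matchingOf-injective : ∀ {k n} (a a' : Comp k) (b b' : Comp n) → ones a ≡ ones b → ones a' ≡ ones b' →
  matchingOf a b ≡ matchingOf a' b' → a ≡ a' × b ≡ b'
matchingOf-injective (two a) (two a') b b' bal bal' e
  with matchingOf-injective a a' b b' bal bal' (extend-injective arc₁ _ _ e)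
... | refl , refl = refl , refl
matchingOf-injective (two a) (one a') b b' bal bal' e with leftmost-rung a' b' bal'
... | j , to-j with trans (cong (λ R → partner R (inj₁ Fin.zero)) e) to-j
... | ()
matchingOf-injective (one a) (two a') b b' bal bal' e with leftmost-rung a b bal
... | j , to-j with trans (sym (cong (λ R → partner R (inj₁ Fin.zero)) e)) to-j
... | ()
matchingOf-injective done done done done bal bal' e = refl , refl
matchingOf-injective done done (two b) (two b') bal bal' e
  with matchingOf-injective done done b b' bal bal' (extend-injective arc₂ _ _ e)
... | _ , refl = refl , refl
matchingOf-injective (one a) (one a') (two b) (two b') bal bal' e
  with matchingOf-injective (one a) (one a') b b' bal bal' (extend-injective arc₂ _ _ e)
... | refl , refl = refl , refl
matchingOf-injective (one a) (one a') (one b) (one b') bal bal' e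
  with matchingOf-injective a a' b b' (suc-injective bal) (suc-injective bal') (extend-injective rung _ _ e)
... | refl , refl = refl , refl
matchingOf-injective (one a) (one a') (two b) (one b') bal bal' e with cong (λ R → partner R (inj₂ Fin.zero)) e
... | ()
matchingOf-injective (one a) (one a') (one b) (two b') bal bal' e with cong (λ R → partner R (inj₂ Fin.zero)) e
... | ()
matchingOf-injective done done (one b) _ () bal' e
matchingOf-injective done done (two b) (one b') bal () e
matchingOf-injective (one a) _ done _ () bal' e

Decoding : ∀ {k n} → Pairing k n → Set
Decoding {k} {n} P = Σ (Comp k) λ a → Σ (Comp n) λ b → ones a ≡ ones b × matchingOf a b ≡ P

segments-apart : ∀ {k n} {P : Pairing k n} → IsMatching P → ∀ x y → y ≢ x → y ≢ partner P x →
  ∀ {p q} → partner P x ≡ p → partner P y ≡ q → meet x p y q ≡ false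
segments-apart matching x y y≢x y≢x' refl refl = non-crossing (matching x) y y≢x y≢x'

-- The leftmost point of a line is not matched with a point of the same line
-- beyond the second one: that segment would contain the second point.
no-enclosing₁ : ∀ {k n} {P : Pairing (suc (suc k)) n} {i : Fin k} → IsMatching P →
  partner P (inj₁ Fin.zero) ≡ inj₁ (Fin.suc (Fin.suc i)) → ⊥
no-enclosing₁ {P = P} {i} matching e = true≢false (trans (sym (encloses (partner P (inj₁ (Fin.suc Fin.zero)))))
  (segments-apart matching (inj₁ Fin.zero) (inj₁ (Fin.suc Fin.zero)) (λ ()) (λ q → second≢ (trans q e)) e refl))
  where
  second≢ : inj₁ (Fin.suc Fin.zero) ≢ inj₁ (Fin.suc (Fin.suc i))
  second≢ ()
  encloses : ∀ y → meet (inj₁ Fin.zero) (inj₁ (Fin.suc (Fin.suc _))) (inj₁ (Fin.suc Fin.zero)) y ≡ true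
  encloses (inj₁ Fin.zero)    = refl
  encloses (inj₁ (Fin.suc _)) = refl
  encloses (inj₂ _)           = refl

no-enclosing₂ : ∀ {k n} {P : Pairing k (suc (suc n))} {j : Fin n} → IsMatching P →
  partner P (inj₂ Fin.zero) ≡ inj₂ (Fin.suc (Fin.suc j)) → ⊥
no-enclosing₂ {P = P} {j} matching e = true≢false (trans (sym (encloses (partner P (inj₂ (Fin.suc Fin.zero)))))
  (segments-apart matching (inj₂ Fin.zero) (inj₂ (Fin.suc Fin.zero)) (λ ()) (λ q → second≢ (trans q e)) e refl))
  where
  second≢ : inj₂ (Fin.suc Fin.zero) ≢ inj₂ (Fin.suc (Fin.suc j))
  second≢ ()
  encloses : ∀ y → meet (inj₂ Fin.zero) (inj₂ (Fin.suc (Fin.suc _))) (inj₂ (Fin.suc Fin.zero)) y ≡ true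
  encloses (inj₂ Fin.zero)    = refl
  encloses (inj₂ (Fin.suc _)) = refl
  encloses (inj₁ _)           = refl

decode-matching : ∀ k n (P : Pairing k n) → IsMatching P → Decoding P

decode-arc₁ : ∀ {k n} (P : Pairing (suc (suc k)) n) → IsMatching P →
  partner P (inj₁ Fin.zero) ≡ inj₁ (Fin.suc Fin.zero) → Decoding P
decode-arc₁ {k} {n} P matching e =
  let (Q , matching-Q , extends) = restrict arc₁ P matching e
      (a , b , bal , encodes) = decode-matching k n Q matching-Q
  in two a , b , bal , trans (cong addArc₁ encodes) extends

decode-arc₂ : ∀ {k n} (P : Pairing k (suc (suc n))) → IsMatching P →
  partner P (inj₂ Fin.zero) ≡ inj₂ (Fin.suc Fin.zero) → Decoding P
decode-arc₂ {k} {n} P matching e =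
  let (Q , matching-Q , extends) = restrict arc₂ P matching e
      (a , b , bal , encodes) = decode-matching k n Q matching-Q
  in a , two b , bal , trans (matchingOf-two₂ a b) (trans (cong addArc₂ encodes) extends)

decode-rung : ∀ {k n} (P : Pairing (suc k) (suc n)) → IsMatching P →
  partner P (inj₁ Fin.zero) ≡ inj₂ Fin.zero → Decoding P
decode-rung {k} {n} P matching e =
  let (Q , matching-Q , extends) = restrict rung P matching e
      (a , b , bal , encodes) = decode-matching k n Q matching-Q
  in one a , one b , cong suc bal , trans (cong addRung encodes) extends

-- Every matching is the matching of a balanced pair of compositions: look at
-- the partners of the leftmost points of line 1 and of line 2.
decode-matching zero zero ([] , []) matching = done , done , refl , refl
decode-matching zero (suc n) P matching with partner P (inj₂ Fin.zero) in e₂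
... | inj₂ Fin.zero               = ⊥-elim (no-loop (matching (inj₂ Fin.zero)) e₂)
... | inj₂ (Fin.suc Fin.zero)     = decode-arc₂ P matching e₂
... | inj₂ (Fin.suc (Fin.suc _))  = ⊥-elim (no-enclosing₂ matching e₂)
decode-matching (suc k) zero P matching with partner P (inj₁ Fin.zero) in e₁
... | inj₁ Fin.zero               = ⊥-elim (no-loop (matching (inj₁ Fin.zero)) e₁)
... | inj₁ (Fin.suc Fin.zero)     = decode-arc₁ P matching e₁
... | inj₁ (Fin.suc (Fin.suc _))  = ⊥-elim (no-enclosing₁ matching e₁)
decode-matching (suc k) (suc n) P matching with partner P (inj₁ Fin.zero) in e₁
... | inj₁ Fin.zero               = ⊥-elim (no-loop (matching (inj₁ Fin.zero)) e₁)
... | inj₁ (Fin.suc Fin.zero)     = decode-arc₁ P matching e₁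
... | inj₁ (Fin.suc (Fin.suc _))  = ⊥-elim (no-enclosing₁ matching e₁)
... | inj₂ j with partner P (inj₂ Fin.zero) in e₂
...   | inj₂ Fin.zero              = ⊥-elim (no-loop (matching (inj₂ Fin.zero)) e₂)
...   | inj₂ (Fin.suc Fin.zero)    = decode-arc₂ P matching e₂
...   | inj₂ (Fin.suc (Fin.suc _)) = ⊥-elim (no-enclosing₂ matching e₂)
decode-matching (suc k) (suc n) P matching | inj₂ Fin.zero | inj₁ Fin.zero = decode-rung P matching e₁
decode-matching (suc k) (suc n) P matching | inj₂ (Fin.suc _) | inj₁ Fin.zero
  with trans (sym e₁) (trans (sym (cong (partner P) e₂)) (involution (matching (inj₂ Fin.zero))))
... | ()
decode-matching (suc k) (suc n) P matching | inj₂ Fin.zero | inj₁ (Fin.suc _)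
  with trans (sym e₂) (trans (sym (cong (partner P) e₁)) (involution (matching (inj₁ Fin.zero))))
... | ()
decode-matching (suc k) (suc n) P matching | inj₂ (Fin.suc j) | inj₁ (Fin.suc _) =
  ⊥-elim (true≢false (segments-apart matching (inj₁ Fin.zero) (inj₂ Fin.zero) (λ ()) (λ q → rung≢ (trans q e₁)) e₁ e₂))
  where
  rung≢ : inj₂ Fin.zero ≢ inj₂ (Fin.suc j)
  rung≢ ()

a≡balancedPairs : ∀ k n → a k n ≡ balancedPairs k n
a≡balancedPairs k n = begin
  a k n
    ≡⟨ count≡∑ validPairing (allPairings k n) ⟩
  ∑ (allPairings k n) (𝟙 ∘ validPairing)
    ≡⟨ count-by-bijection (Eq× (EqVec (EqPoint k n) k) (EqVec (EqPoint k n) n)) (Eq× (EqComp k) (EqComp n))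
         (allPairings k n) (cartesianProduct (comps k) (comps n))
         (cartesian-listing (EqVec (EqPoint k n) k) (EqVec (EqPoint k n) n)
            (vecsOver (allPoints k n) k) (vecsOver (allPoints k n) n) (partners k) (partners n))
         (comp-pairs-listing k n) validPairing balanced encode into onto inj ⟩
  balancedPairs k n ∎
  where
  open ≡-Reasoning
  partners : ∀ m → Listing (EqVec (EqPoint k n) m) (vecsOver (allPoints k n) m)
  partners = vecsOver-listing (EqPoint k n) (allPoints k n) (allPoints-listing k n)
  encode : Comp k × Comp n → Pairing k n
  encode (c₁ , c₂) = matchingOf c₁ c₂
  into : ∀ c → balanced c ≡ true → validPairing (encode c) ≡ true
  into (c₁ , c₂) bal = IsMatching⇒validPairing (matchingOf c₁ c₂) (matchingOf-matching c₁ c₂ (≡ᵇ-sound _ _ bal))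
  onto : ∀ P → validPairing P ≡ true → Σ (Comp k × Comp n) λ c → balanced c ≡ true × encode c ≡ P
  onto P valid with decode-matching k n P (validPairing⇒IsMatching P valid)
  ... | c₁ , c₂ , bal , encodes = (c₁ , c₂) , subst (λ m → (ones c₁ ≡ᵇ m) ≡ true) bal (≡ᵇ-refl (ones c₁)) , encodes
  inj : ∀ c c' → balanced c ≡ true → balanced c' ≡ true → encode c ≡ encode c' → c ≡ c'
  inj (c₁ , c₂) (c₁' , c₂') bal bal' e
    with matchingOf-injective c₁ c₁' c₂ c₂' (≡ᵇ-sound _ _ bal) (≡ᵇ-sound _ _ bal') e
  ... | refl , refl = refl

theorem2 : (k n : ℕ) → d k n ≡ a k n
theorem2 k n = begin
  d k n             ≡⟨ d≡balancedPairs k n ⟩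
  balancedPairs k n ≡⟨ sym (a≡balancedPairs k n) ⟩
  a k n             ∎
  where open ≡-Reasoning
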